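{- For every integer $s \geqslant 1$, the graph $K_{8s+6} - K_3$ has a quadrangular embedding in the closed orientable surface $S_{8s^2+7s+1}$.
   Context: $K_p - K_i$ denotes the graph obtained from the complete graph $K_p$ by deleting all edges of a fixed complete subgraph $K_i$ (keeping all vertices). A quadrangular embedding is a 2-cell embedding in which every face has length exactly $4$. $S_h$ denotes the closed orientable surface of genus $h$. -}

module Defs where

open import Data.Nat using (ℕ; zero; suc; _+_; _*_; _<ᵇ_; _≤ᵇ_; _≡ᵇ_)
open import Data.Bool using (Bool; true; false; T; not; _∧_)
open import Data.Fin using (Fin; toℕ)
open import Data.Product using (_×_; _,_; ∃-syntax; Σ)
open import Data.List using (List; length; allFin; cartesianProduct; filterᵇ; and; map; upTo)
open import Relation.Binary.PropositionalEquality using (_≡_; _≢_)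

iter : {A : Set} → (A → A) → ℕ → A → A
iter f zero    x = x
iter f (suc k) x = f (iter f k x)

-- The graph K_p - K_i on vertex set Fin p: the deleted complete subgraph K_i
-- is (w.l.o.g.) the one spanned by the vertices 0, …, i-1.
-- Boolean adjacency: u ≠ v and not both u, v among the first i vertices.
adjᵇ : {p : ℕ} → ℕ → Fin p → Fin p → Bool
adjᵇ i u v = not (toℕ u ≡ᵇ toℕ v) ∧ not ((toℕ u <ᵇ i) ∧ (toℕ v <ᵇ i))

Adj : {p : ℕ} → ℕ → Fin p → Fin p → Set
Adj i u v = T (adjᵇ i u v)

-- The values of rot v on non-neighbours
-- are irrelevant.  "Cyclic" = rot v maps N(v) into N(v) and every neighbour
-- is reachable from every neighbour (a single cycle on the finite set N(v)).
record RotationSystem (p i : ℕ) : Set where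
  field
    rot        : Fin p → Fin p → Fin p
    rot-adj    : ∀ v u → Adj i v u → Adj i v (rot v u)
    rot-cyclic : ∀ v u w → Adj i v u → Adj i v w →
                 ∃[ k ] iter (rot v) k u ≡ w

module _ {p i : ℕ} (R : RotationSystem p i) where
  open RotationSystem R

  Dart : Set
  Dart = Fin p × Fin p

  -- face-tracing permutation (Heffter–Edmonds): dart (u,v) is followed
  -- by (v, rot v u)
  faceStep : Dart → Dart
  faceStep (u , v) = (v , rot v u)

  darts : List Dart
  darts = filterᵇ (λ { (u , v) → adjᵇ i u v }) (cartesianProduct (allFin p) (allFin p))

  key : Dart → ℕ
  key (u , v) = toℕ u * p + toℕ v

  -- a dart is the representative of its face iff it has the least key
  -- on its faceStep-orbit (orbits have length ≤ p * p)
  isRep : Dart → Bool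
  isRep d = and (map (λ k → key d ≤ᵇ key (iter faceStep k d)) (upTo (p * p)))

  numFaces : ℕ
  numFaces = length (filterᵇ isRep darts)

  numEdges : ℕ
  numEdges = length (filterᵇ (λ { (u , v) → toℕ u <ᵇ toℕ v }) darts)

  Quadrangular : Set
  Quadrangular = ∀ u v → Adj i u v →
    (iter faceStep 4 (u , v) ≡ (u , v)) ×
    (iter faceStep 1 (u , v) ≢ (u , v)) ×
    (iter faceStep 2 (u , v) ≢ (u , v)) ×
    (iter faceStep 3 (u , v) ≢ (u , v))

  -- the embedding determined by R lies in S_h: Euler's formula V - E + F = 2 - 2h
  HasGenus : ℕ → Set
  HasGenus h = p + numFaces + 2 * h ≡ numEdges + 2

QuadEmbedding : ℕ → ℕ → ℕ → Set
QuadEmbedding p i h = Σ (RotationSystem p i) (λ R → Quadrangular R × HasGenus R h)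

module Submission where

-- Write p = 8s + 6 and m = 8s + 3, and identify the vertices 3, …, p - 1 of K_p - K_3 with ℤ_m.
-- Every residue gets the same rotation σ of its neighbours, written in local coordinates as the
-- currents ±1, …, ±(4s + 1) and the three triangle vertices 0, 1, 2; the rotation at a triangle
-- vertex is a translation of ℤ_m.  Face tracing then acts on local coordinates by τ = σ ∘ reverse,
-- and a face closes as soon as its currents sum to 0 modulo m.  The faces are the τ-cycles
-- +y, +(y+1), -(y-1), -(y+2) for even y, and one 4-cycle through each triangle vertex for every
-- residue, so the embedding is quadrangular; σ and the translations are single cycles, so it is a
-- rotation system.  Euler's formula with 4F = 2E = #darts = (p - 3)(p + 2) gives the genus.

open import Defs
open import Data.Bool using (Bool; true; false; T; not; _∧_; if_then_else_)
open import Data.Bool.Properties using (T-∧)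
open import Data.Empty using (⊥; ⊥-elim)
open import Data.Fin using (Fin; toℕ; combine; remQuot; fromℕ<)
import Data.Fin as Fin
open import Data.Fin.Properties using (toℕ-injective; toℕ-combine; remQuot-combine; toℕ-fromℕ<; toℕ<n)
open import Data.List using (List; []; _∷_; _++_; [_]; length; map; filterᵇ; cartesianProduct; allFin; upTo; applyUpTo; tabulate)
open import Data.List.Extrema.Nat using (argmin; f[argmin]≤f[xs]; argmin-all)
open import Data.List.Membership.Propositional using (_∈_)
open import Data.List.Membership.Propositional.Properties
  using (∈-filter⁺; ∈-filter⁻; ∈-map⁺; ∈-map⁻; ∈-++⁺ˡ; ∈-++⁺ʳ; ∈-++⁻; ∈-cartesianProduct⁺; ∈-cartesianProduct⁻; ∈-allFin; ∈-upTo⁺; ∈-upTo⁻; ∈-applyUpTo⁻)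
open import Data.List.Membership.Propositional.Properties.WithK using (unique∧set⇒bag)
open import Data.List.Properties
  using (length-++; length-map; length-applyUpTo; length-upTo; map-++; map-∘; map-cong; map-tabulate; map-upTo; upTo-∷ʳ; ++-assoc; ++-identityʳ; filter-++; filter-all; filter-none)
open import Data.List.Relation.Binary.BagAndSetEquality using (∼bag⇒↭)
open import Data.List.Relation.Binary.Permutation.Propositional.Properties using (↭-length)
open import Data.List.Relation.Unary.All as All using (All; []; _∷_)
import Data.List.Relation.Unary.All.Properties as All
open import Data.List.Relation.Unary.Any using (here; there)
open import Data.List.Relation.Unary.Unique.Propositional using (Unique; []; _∷_)
import Data.List.Relation.Unary.Unique.Propositional.Properties as Unique
open import Data.Nat
open import Data.Nat.DivMod using (_%_; _/_; m≡m%n+[m/n]*n; m%n<n; m%n%n≡m%n; [m+n]%n≡m%n; [m+kn]%n≡m%n; %-distribˡ-+; m<n⇒m%n≡m; n%n≡0)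
open import Data.Nat.ListAction using (sum)
open import Data.Nat.ListAction.Properties using (sum-++)
open import Data.Nat.Properties
open import Data.Nat.Solver using (module +-*-Solver)
open import Data.Product using (∃-syntax; _×_; _,_; proj₁; proj₂)
open import Data.Sum using (_⊎_; inj₁; inj₂)
open import Data.Unit using (⊤; tt)
open import Function using (_∘_; _⇔_; mk⇔; Equivalence)
open import Relation.Binary using (tri<; tri≈; tri>)
open import Relation.Binary.PropositionalEquality using (_≡_; _≢_; refl; sym; trans; cong; cong₂; subst; module ≡-Reasoning)
open import Relation.Nullary using (¬_; yes; no)
open import Relation.Nullary.Decidable using (T?)

open +-*-Solver using (solve; _:+_; _:*_; con; _:=_)

private
  variable
    A B : Set

-- Iteration, lists and parity

module _ (f : A → A) where

  iter-+ : ∀ m n x → iter f (m + n) x ≡ iter f m (iter f n x)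
  iter-+ zero    n x = refl
  iter-+ (suc m) n x = cong f (iter-+ m n x)

  iter-fixed : ∀ {x} → f x ≡ x → ∀ k → iter f k x ≡ x
  iter-fixed e zero    = refl
  iter-fixed e (suc k) = trans (cong f (iter-fixed e k)) e

  iter-* : ∀ {n x} → iter f n x ≡ x → ∀ t → iter f (t * n) x ≡ x
  iter-* e zero = refl
  iter-* {n} {x} e (suc t) = trans (iter-+ n (t * n) x) (trans (cong (iter f n) (iter-* e t)) e)

  iter-% : ∀ {n x} .{{_ : NonZero n}} → iter f n x ≡ x → ∀ k → iter f k x ≡ iter f (k % n) x
  iter-% {n} {x} e k = begin
    iter f k x                              ≡⟨ cong (λ j → iter f j x) (m≡m%n+[m/n]*n k n) ⟩
    iter f (k % n + k / n * n) x            ≡⟨ iter-+ (k % n) (k / n * n) x ⟩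
    iter f (k % n) (iter f (k / n * n) x)   ≡⟨ cong (iter f (k % n)) (iter-* e (k / n)) ⟩
    iter f (k % n) x                        ∎
    where open ≡-Reasoning

  iter-inverse : ∀ {n x} .{{_ : NonZero n}} → iter f n x ≡ x → ∀ k → iter f ((n ∸ 1) * k) (iter f k x) ≡ x
  iter-inverse {suc n} {x} e k = begin
    iter f (n * k) (iter f k x)   ≡⟨ iter-+ (n * k) k x ⟨
    iter f (n * k + k) x          ≡⟨ cong (λ j → iter f j x) (trans (+-comm (n * k) k) (*-comm (suc n) k)) ⟩
    iter f (k * suc n) x          ≡⟨ iter-* e k ⟩
    x                             ∎
    where open ≡-Reasoning

same-members⇒same-length : {xs ys : List A} → Unique xs → Unique ys →
  (∀ {x} → x ∈ xs → x ∈ ys) → (∀ {x} → x ∈ ys → x ∈ xs) → length xs ≡ length ys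
same-members⇒same-length ux uy to from = ↭-length (∼bag⇒↭ (unique∧set⇒bag ux uy (mk⇔ to from)))

Unique-map⁺ : (g : A → B) {xs : List A} → Unique xs →
  (∀ {x y} → x ∈ xs → y ∈ xs → g x ≡ g y → x ≡ y) → Unique (map g xs)
Unique-map⁺ g {[]}     []          inj = []
Unique-map⁺ g {x ∷ xs} (x∉ ∷ uxs) inj =
  All.map⁺ (All.tabulate (λ y∈ gx≡gy → All.lookup x∉ y∈ (inj (here refl) (there y∈) gx≡gy)))
  ∷ Unique-map⁺ g uxs (λ x∈ y∈ → inj (there x∈) (there y∈))

module _ (P : A → Bool) where

  ∈-filterᵇ⁺ : ∀ {x xs} → x ∈ xs → T (P x) → x ∈ filterᵇ P xs
  ∈-filterᵇ⁺ = ∈-filter⁺ (T? ∘ P)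

  ∈-filterᵇ⁻ : ∀ {x xs} → x ∈ filterᵇ P xs → x ∈ xs × T (P x)
  ∈-filterᵇ⁻ = ∈-filter⁻ (T? ∘ P)

  Unique-filterᵇ⁺ : ∀ {xs} → Unique xs → Unique (filterᵇ P xs)
  Unique-filterᵇ⁺ = Unique.filter⁺ (T? ∘ P)

  length-filterᵇ-all : ∀ {xs} → All (T ∘ P) xs → length (filterᵇ P xs) ≡ length xs
  length-filterᵇ-all all = cong length (filter-all (T? ∘ P) all)

  length-filterᵇ-none : ∀ {xs} → All (¬_ ∘ T ∘ P) xs → length (filterᵇ P xs) ≡ 0
  length-filterᵇ-none none = cong length (filter-none (T? ∘ P) none)

  length-filterᵇ-++ : ∀ xs ys → length (filterᵇ P (xs ++ ys)) ≡ length (filterᵇ P xs) + length (filterᵇ P ys)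
  length-filterᵇ-++ xs ys = trans (cong length (filter-++ (T? ∘ P) xs ys)) (length-++ (filterᵇ P xs))

length-filterᵇ-map : (P : B → Bool) (g : A → B) (xs : List A) →
  length (filterᵇ P (map g xs)) ≡ length (filterᵇ (P ∘ g) xs)
length-filterᵇ-map P g []       = refl
length-filterᵇ-map P g (x ∷ xs) with P (g x)
... | true  = cong suc (length-filterᵇ-map P g xs)
... | false = length-filterᵇ-map P g xs

length-cartesianProduct : (xs : List A) (ys : List B) →
  length (cartesianProduct xs ys) ≡ length xs * length ys
length-cartesianProduct []       ys = refl
length-cartesianProduct (x ∷ xs) ys = begin
  length (map (x ,_) ys ++ cartesianProduct xs ys)          ≡⟨ length-++ (map (x ,_) ys) ⟩
  length (map (x ,_) ys) + length (cartesianProduct xs ys)  ≡⟨ cong₂ _+_ (length-map (x ,_) ys) (length-cartesianProduct xs ys) ⟩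
  length ys + length xs * length ys                         ∎
  where open ≡-Reasoning

length-filterᵇ-cartesianProduct : (P : A × B → Bool) (xs : List A) (ys : List B) →
  length (filterᵇ P (cartesianProduct xs ys)) ≡ sum (map (λ x → length (filterᵇ (λ y → P (x , y)) ys)) xs)
length-filterᵇ-cartesianProduct P []       ys = refl
length-filterᵇ-cartesianProduct P (x ∷ xs) ys =
  trans (length-filterᵇ-++ P (map (x ,_) ys) (cartesianProduct xs ys))
        (cong₂ _+_ (length-filterᵇ-map P (x ,_) ys) (length-filterᵇ-cartesianProduct P xs ys))

sum-map-const : ∀ (g : A → ℕ) {c} (xs : List A) → (∀ {x} → x ∈ xs → g x ≡ c) → sum (map g xs) ≡ length xs * c
sum-map-const g []       gc = refl
sum-map-const g (x ∷ xs) gc = cong₂ _+_ (gc (here refl)) (sum-map-const g xs (gc ∘ there))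

upTo-+ : ∀ m n → upTo (m + n) ≡ upTo m ++ map (m +_) (upTo n)
upTo-+ m zero    = trans (cong upTo (+-identityʳ m)) (sym (++-identityʳ (upTo m)))
upTo-+ m (suc n) = begin
  upTo (m + suc n)                                   ≡⟨ cong upTo (+-suc m n) ⟩
  upTo (suc (m + n))                                 ≡⟨ upTo-∷ʳ (m + n) ⟨
  upTo (m + n) ++ [ m + n ]                          ≡⟨ cong (_++ [ m + n ]) (upTo-+ m n) ⟩
  (upTo m ++ map (m +_) (upTo n)) ++ [ m + n ]       ≡⟨ ++-assoc (upTo m) _ _ ⟩
  upTo m ++ (map (m +_) (upTo n) ++ [ m + n ])       ≡⟨ cong (upTo m ++_) (map-++ (m +_) (upTo n) [ n ]) ⟨
  upTo m ++ map (m +_) (upTo n ++ [ n ])             ≡⟨ cong (λ l → upTo m ++ map (m +_) l) (upTo-∷ʳ n) ⟩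
  upTo m ++ map (m +_) (upTo (suc n))                ∎
  where open ≡-Reasoning

map-toℕ-allFin : ∀ n → map toℕ (allFin n) ≡ upTo n
map-toℕ-allFin zero    = refl
map-toℕ-allFin (suc n) = cong (0 ∷_) (begin
  map toℕ (tabulate Fin.suc)   ≡⟨ map-tabulate Fin.suc toℕ ⟩
  tabulate (suc ∘ toℕ)         ≡⟨ map-tabulate (λ i → i) (suc ∘ toℕ) ⟨
  map (suc ∘ toℕ) (allFin n)   ≡⟨ map-∘ (allFin n) ⟩
  map suc (map toℕ (allFin n)) ≡⟨ cong (map suc) (map-toℕ-allFin n) ⟩
  map suc (upTo n)             ≡⟨ map-upTo suc n ⟩
  applyUpTo suc n              ∎)
  where open ≡-Reasoning

if-T : ∀ {b} {x y : A} → T b → (if b then x else y) ≡ x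
if-T {b = true} _ = refl

if-¬T : ∀ {b} {x y : A} → ¬ T b → (if b then x else y) ≡ y
if-¬T {b = true}  ¬t = ⊥-elim (¬t _)
if-¬T {b = false} _  = refl

iter-4-cycle : ∀ {F : A → A} {a b c d} → F a ≡ b → F b ≡ c → F c ≡ d → F d ≡ a → iter F 4 a ≡ a
iter-4-cycle refl refl refl closes = closes

even : ℕ → Bool
even zero          = true
even (suc zero)    = false
even (suc (suc k)) = even k

even-double : ∀ k → T (even (k + k))
even-double zero    = _
even-double (suc k) rewrite +-suc k k = even-double k

odd-double : ∀ k → ¬ T (even (suc (k + k)))
odd-double zero    ()
odd-double (suc k) rewrite +-suc k k = odd-double k

even-or-odd : ∀ a → (∃[ k ] a ≡ k + k) ⊎ (∃[ k ] a ≡ suc (k + k))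
even-or-odd zero          = inj₁ (0 , refl)
even-or-odd (suc zero)    = inj₂ (0 , refl)
even-or-odd (suc (suc a)) with even-or-odd a
... | inj₁ (k , refl) = inj₁ (suc k , cong suc (sym (+-suc k k)))
... | inj₂ (k , refl) = inj₂ (suc k , cong (suc ∘ suc) (sym (+-suc k k)))

double≢odd : ∀ k l → k + k ≢ suc (l + l)
double≢odd k l e = odd-double l (subst (T ∘ even) e (even-double k))

double-<-step : ∀ k l → k + k < l + l → 2 + (k + k) ≤ l + l
double-<-step k l lt with <-cmp k l
... | tri< k<l _ _ = subst (λ x → suc x ≤ l + l) (+-suc k k) (+-mono-≤ k<l k<l)
... | tri≈ _ refl _ = ⊥-elim (<-irrefl refl lt)
... | tri> _ _ l<k = ⊥-elim (<⇒≱ lt (+-mono-≤ (<⇒≤ l<k) (<⇒≤ l<k)))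

half-< : ∀ {k l} → k + k < l + l → k < l
half-< {k} {l} lt = ≰⇒> (λ l≤k → <⇒≱ lt (+-mono-≤ l≤k l≤k))

half-≤ : ∀ {k l} → k + k ≤ l + l → k ≤ l
half-≤ {k} {l} le = ≮⇒≥ (λ l<k → <⇒≱ (+-mono-< l<k l<k) le)

if-elim : ∀ (P : A → Set) b {x y} → (T b → P x) → (¬ T b → P y) → P (if b then x else y)
if-elim P true  t _ = t _
if-elim P false _ f = f (λ ())

-- Darts, edges and faces of K_p - K_i

Adjℕ : ℕ → ℕ → ℕ → Set
Adjℕ i x y = x ≢ y × ¬ (x < i × y < i)

Adjℕ-sym : ∀ {i x y} → Adjℕ i x y → Adjℕ i y x
Adjℕ-sym (x≢y , ¬both) = (λ y≡x → x≢y (sym y≡x)) , (λ (y<i , x<i) → ¬both (x<i , y<i))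

adjℕᵇ : ℕ → ℕ → ℕ → Bool
adjℕᵇ i x y = not (x ≡ᵇ y) ∧ not ((x <ᵇ i) ∧ (y <ᵇ i))

T-not : ∀ {b} → T (not b) ⇔ (¬ T b)
T-not {true}  = mk⇔ (λ ()) (λ ¬t → ¬t _)
T-not {false} = mk⇔ (λ _ ()) (λ _ → _)

T-adjℕᵇ : ∀ i x y → T (adjℕᵇ i x y) ⇔ Adjℕ i x y
T-adjℕᵇ i x y = mk⇔ to from
  where
  to : T (adjℕᵇ i x y) → Adjℕ i x y
  to t with Equivalence.to T-∧ t
  ... | t≢ , t¬both =
    (λ x≡y → Equivalence.to T-not t≢ (≡⇒≡ᵇ x y x≡y)) ,
    (λ (x<i , y<i) → Equivalence.to T-not t¬both (Equivalence.from T-∧ (<⇒<ᵇ x<i , <⇒<ᵇ y<i)))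
  from : Adjℕ i x y → T (adjℕᵇ i x y)
  from (x≢y , ¬both) = Equivalence.from T-∧
    ( Equivalence.from T-not (λ t → x≢y (≡ᵇ⇒≡ x y t))
    , Equivalence.from T-not (λ t → let (x<i , y<i) = Equivalence.to T-∧ t in ¬both (<ᵇ⇒< x i x<i , <ᵇ⇒< y i y<i)))

Adj⇔Adjℕ : ∀ {p} {i} {u v : Fin p} → Adj i u v ⇔ Adjℕ i (toℕ u) (toℕ v)
Adj⇔Adjℕ {i = i} {u} {v} = T-adjℕᵇ i (toℕ u) (toℕ v)

Adj-sym : ∀ {p} i (u v : Fin p) → Adj i u v → Adj i v u
Adj-sym i u v a = Equivalence.from (Adj⇔Adjℕ {i = i} {v} {u}) (Adjℕ-sym (Equivalence.to (Adj⇔Adjℕ {i = i} {u} {v}) a))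

Adj-irrefl : ∀ {p} i (u v : Fin p) → Adj i u v → u ≢ v
Adj-irrefl i u v a u≡v = proj₁ (Equivalence.to (Adj⇔Adjℕ {i = i} {u} {v}) a) (cong toℕ u≡v)

degree : ℕ → ℕ → ℕ → ℕ
degree i p x = length (filterᵇ (adjℕᵇ i x) (upTo p))

degree-deleted : ∀ {i x} k → x < i → degree i (i + k) x ≡ k
degree-deleted {i} {x} k x<i = begin
  length (filterᵇ (adjℕᵇ i x) (upTo (i + k)))                        ≡⟨ cong (length ∘ filterᵇ (adjℕᵇ i x)) (upTo-+ i k) ⟩
  length (filterᵇ (adjℕᵇ i x) (upTo i ++ map (i +_) (upTo k)))       ≡⟨ length-filterᵇ-++ (adjℕᵇ i x) (upTo i) _ ⟩
  length (filterᵇ (adjℕᵇ i x) (upTo i)) + length (filterᵇ (adjℕᵇ i x) (map (i +_) (upTo k)))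
    ≡⟨ cong₂ _+_ (length-filterᵇ-none (adjℕᵇ i x) (All.tabulate nonadjacent)) (length-filterᵇ-all (adjℕᵇ i x) (All.tabulate adjacent)) ⟩
  length (map (i +_) (upTo k))                                       ≡⟨ trans (length-map (i +_) (upTo k)) (length-upTo k) ⟩
  k                                                                  ∎
  where
  open ≡-Reasoning
  nonadjacent : ∀ {y} → y ∈ upTo i → ¬ T (adjℕᵇ i x y)
  nonadjacent y∈ t = proj₂ (Equivalence.to (T-adjℕᵇ i x _) t) (x<i , ∈-upTo⁻ y∈)
  adjacent : ∀ {y} → y ∈ map (i +_) (upTo k) → T (adjℕᵇ i x y)
  adjacent y∈ with ∈-map⁻ _ y∈
  ... | j , _ , refl = Equivalence.from (T-adjℕᵇ i x (i + j))
        ((λ x≡ → <⇒≱ x<i (subst (i ≤_) (sym x≡) (m≤m+n i j))) , (λ (_ , i+j<i) → <⇒≱ i+j<i (m≤m+n i j)))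

degree-kept : ∀ {i x} r → i ≤ x → degree i (x + suc r) x ≡ x + r
degree-kept {i} {x} r i≤x = begin
  length (filterᵇ P (upTo (x + suc r)))                                ≡⟨ cong (length ∘ filterᵇ P) (upTo-+ x (suc r)) ⟩
  length (filterᵇ P (upTo x ++ [ x + 0 ] ++ map (x +_) (applyUpTo suc r)))
    ≡⟨ length-filterᵇ-++ P (upTo x) _ ⟩
  length (filterᵇ P (upTo x)) + length (filterᵇ P ([ x + 0 ] ++ map (x +_) (applyUpTo suc r)))
    ≡⟨ cong (length (filterᵇ P (upTo x)) +_) (length-filterᵇ-++ P [ x + 0 ] _) ⟩
  length (filterᵇ P (upTo x)) + (length (filterᵇ P [ x + 0 ]) + length (filterᵇ P (map (x +_) (applyUpTo suc r))))
    ≡⟨ cong₂ _+_ (length-filterᵇ-all P (All.tabulate below))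
                 (cong₂ _+_ (length-filterᵇ-none P (All.tabulate itself)) (length-filterᵇ-all P (All.tabulate above))) ⟩
  length (upTo x) + length (map (x +_) (applyUpTo suc r))             ≡⟨ cong₂ _+_ (length-upTo x) (trans (length-map (x +_) (applyUpTo suc r)) (length-applyUpTo suc r)) ⟩
  x + r                                                                ∎
  where
  open ≡-Reasoning
  P : ℕ → Bool
  P = adjℕᵇ i x
  kept : ∀ {y} → ¬ (x < i × y < i)
  kept (x<i , _) = <⇒≱ x<i i≤x
  below : ∀ {y} → y ∈ upTo x → T (P y)
  below y∈ = Equivalence.from (T-adjℕᵇ i x _) ((λ x≡y → <-irrefl (sym x≡y) (∈-upTo⁻ y∈)) , kept)
  itself : ∀ {y} → y ∈ [ x + 0 ] → ¬ T (P y)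
  itself (here refl) t = proj₁ (Equivalence.to (T-adjℕᵇ i x _) t) (sym (+-identityʳ x))
  above : ∀ {y} → y ∈ map (x +_) (applyUpTo suc r) → T (P y)
  above y∈ with ∈-map⁻ _ y∈
  ... | z , z∈ , refl with ∈-applyUpTo⁻ suc z∈
  ... | j , _ , refl = Equivalence.from (T-adjℕᵇ i x _) ((λ x≡ → m≢1+m+n x (trans x≡ (+-suc x j))) , kept)

sum-degrees : ∀ i k → sum (map (degree i (i + k)) (upTo (i + k))) ≡ i * k + k * (i + k ∸ 1)
sum-degrees i k = begin
  sum (map deg (upTo (i + k)))                                   ≡⟨ cong (sum ∘ map deg) (upTo-+ i k) ⟩
  sum (map deg (upTo i ++ map (i +_) (upTo k)))                  ≡⟨ cong sum (map-++ deg (upTo i) _) ⟩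
  sum (map deg (upTo i) ++ map deg (map (i +_) (upTo k)))        ≡⟨ sum-++ (map deg (upTo i)) _ ⟩
  sum (map deg (upTo i)) + sum (map deg (map (i +_) (upTo k)))
    ≡⟨ cong₂ _+_ (sum-map-const deg (upTo i) (degree-deleted k ∘ ∈-upTo⁻)) (sum-map-const deg _ deg-kept) ⟩
  length (upTo i) * k + length (map (i +_) (upTo k)) * (i + k ∸ 1)
    ≡⟨ cong₂ (λ a b → a * k + b * (i + k ∸ 1)) (length-upTo i) (trans (length-map (i +_) (upTo k)) (length-upTo k)) ⟩
  i * k + k * (i + k ∸ 1)                                        ∎
  where
  open ≡-Reasoning
  deg : ℕ → ℕ
  deg = degree i (i + k)
  deg-kept : ∀ {x} → x ∈ map (i +_) (upTo k) → deg x ≡ i + k ∸ 1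
  deg-kept x∈ with ∈-map⁻ _ x∈
  ... | j , j∈ , refl with m≤n⇒∃[o]m+o≡n (∈-upTo⁻ j∈)
  ... | r , j+1+r≡k = begin
    length (filterᵇ (adjℕᵇ i (i + j)) (upTo (i + k)))            ≡⟨ cong (λ n → length (filterᵇ (adjℕᵇ i (i + j)) (upTo n))) i+k≡ ⟩
    length (filterᵇ (adjℕᵇ i (i + j)) (upTo (i + j + suc r)))    ≡⟨ degree-kept r (m≤m+n i j) ⟩
    i + j + r                                                    ≡⟨ cong (_∸ 1) (trans i+k≡ (+-suc (i + j) r)) ⟨
    i + k ∸ 1                                                    ∎
    where
    i+k≡ : i + k ≡ i + j + suc r
    i+k≡ = trans (cong (i +_) (sym j+1+r≡k)) (solve 3 (λ i j r → i :+ (con 1 :+ j :+ r) := i :+ j :+ (con 1 :+ r)) refl i j r)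

module _ {p i : ℕ} (R : RotationSystem p i) where
  open RotationSystem R

  private
    isDart : Dart R → Bool
    isDart d = adjᵇ i (proj₁ d) (proj₂ d)

    f : Dart R → Dart R
    f = faceStep R

  ∈-darts⁺ : ∀ {u v} → Adj i u v → (u , v) ∈ darts R
  ∈-darts⁺ {u} {v} = ∈-filterᵇ⁺ isDart (∈-cartesianProduct⁺ (∈-allFin u) (∈-allFin v))

  ∈-darts⁻ : ∀ {u v} → (u , v) ∈ darts R → Adj i u v
  ∈-darts⁻ = proj₂ ∘ ∈-filterᵇ⁻ isDart {xs = cartesianProduct (allFin p) (allFin p)}

  darts-unique : Unique (darts R)
  darts-unique = Unique-filterᵇ⁺ isDart (Unique.cartesianProduct⁺ (Unique.allFin⁺ p) (Unique.allFin⁺ p))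

  rot-fixed-point-free : ∀ {v u w} → Adj i v u → Adj i v w → w ≢ u → rot v u ≢ u
  rot-fixed-point-free {v} {u} {w} vu vw w≢u rvu≡u with rot-cyclic v u w vu vw
  ... | k , uk≡w = w≢u (trans (sym uk≡w) (iter-fixed (rot v) rvu≡u k))

  -- Shorter closures would need a loop, or a rotation fixing a neighbour although it has another one.
  period4⇒quadrangular : (∀ u v → Adj i u v → iter f 4 (u , v) ≡ (u , v)) →
                         (∀ v u → Adj i v u → ∃[ w ] Adj i v w × w ≢ u) → Quadrangular R
  period4⇒quadrangular period4 other-neighbour u v uv = period4 u v uv , one , two , three
    where
    one : f (u , v) ≢ (u , v)
    one e = Adj-irrefl i u v uv (sym (cong proj₁ e))
    two : f (f (u , v)) ≢ (u , v)
    two e with other-neighbour v u (Adj-sym i u v uv)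
    ... | w , vw , w≢u = rot-fixed-point-free (Adj-sym i u v uv) vw w≢u (cong proj₁ e)
    three : iter f 3 (u , v) ≢ (u , v)
    three e = one (sym (trans (sym (period4 u v uv)) (cong f e)))

  length-darts : ∀ {k} → p ≡ i + k → length (darts R) ≡ i * k + k * (i + k ∸ 1)
  length-darts {k} refl = begin
    length (darts R)
      ≡⟨ length-filterᵇ-cartesianProduct isDart (allFin p) (allFin p) ⟩
    sum (map (λ x → length (filterᵇ (λ y → adjᵇ i x y) (allFin p))) (allFin p))
      ≡⟨ cong sum (map-cong (λ x → trans (sym (length-filterᵇ-map (adjℕᵇ i (toℕ x)) toℕ (allFin p)))
                                          (cong (length ∘ filterᵇ (adjℕᵇ i (toℕ x))) (map-toℕ-allFin p))) (allFin p)) ⟩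
    sum (map (deg ∘ toℕ) (allFin p))                       ≡⟨ cong sum (map-∘ (allFin p)) ⟩
    sum (map deg (map toℕ (allFin p)))                     ≡⟨ cong (sum ∘ map deg) (map-toℕ-allFin p) ⟩
    sum (map deg (upTo p))                                 ≡⟨ sum-degrees i k ⟩
    i * k + k * (i + k ∸ 1)                                ∎
    where
    open ≡-Reasoning
    deg : ℕ → ℕ
    deg = degree i p

  -- Each edge {u , v} with u < v contributes the darts (u , v) and (v , u).
  length-darts-edges : length (darts R) ≡ 2 * numEdges R
  length-darts-edges = begin
    length (darts R)                  ≡⟨ same-members⇒same-length darts-unique unique-pairs to from ⟩
    length (Es ++ map swap Es)        ≡⟨ length-++ Es ⟩
    length Es + length (map swap Es)  ≡⟨ cong (length Es +_) (trans (length-map swap Es) (sym (+-identityʳ _))) ⟩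
    2 * length Es                     ∎
    where
    open ≡-Reasoning
    increasing : Dart R → Bool
    increasing (u , v) = toℕ u <ᵇ toℕ v
    Es : List (Dart R)
    Es = filterᵇ increasing (darts R)
    swap : Dart R → Dart R
    swap (u , v) = (v , u)
    increasing⁻ : ∀ {d} → d ∈ Es → d ∈ darts R × toℕ (proj₁ d) < toℕ (proj₂ d)
    increasing⁻ {u , v} d∈ with ∈-filterᵇ⁻ increasing d∈
    ... | d∈darts , t = d∈darts , <ᵇ⇒< (toℕ u) (toℕ v) t
    unique-pairs : Unique (Es ++ map swap Es)
    unique-pairs = Unique.++⁺ uEs (Unique-map⁺ swap uEs (λ _ _ → cong swap))
      (λ (d∈ , d∈swap) → disjoint d∈ d∈swap)
      where
      uEs : Unique Es
      uEs = Unique-filterᵇ⁺ increasing darts-unique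
      disjoint : ∀ {d} → d ∈ Es → d ∈ map swap Es → _
      disjoint {u , v} d∈ d∈swap with ∈-map⁻ swap d∈swap
      ... | (v , u) , e∈ , refl = <-asym (proj₂ (increasing⁻ d∈)) (proj₂ (increasing⁻ e∈))
    to : ∀ {d} → d ∈ darts R → d ∈ Es ++ map swap Es
    to {u , v} d∈ with <-cmp (toℕ u) (toℕ v)
    ... | tri< u<v _ _ = ∈-++⁺ˡ (∈-filterᵇ⁺ increasing d∈ (<⇒<ᵇ u<v))
    ... | tri≈ _ u≡v _ = ⊥-elim (Adj-irrefl i u v (∈-darts⁻ d∈) (toℕ-injective u≡v))
    ... | tri> _ _ v<u = ∈-++⁺ʳ Es (∈-map⁺ swap (∈-filterᵇ⁺ increasing (∈-darts⁺ (Adj-sym i u v (∈-darts⁻ d∈))) (<⇒<ᵇ v<u)))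
    from : ∀ {d} → d ∈ Es ++ map swap Es → d ∈ darts R
    from d∈ with ∈-++⁻ Es d∈
    ... | inj₁ d∈Es  = proj₁ (increasing⁻ d∈Es)
    ... | inj₂ d∈swap with ∈-map⁻ swap d∈swap
    ... | (u , v) , e∈ , refl = ∈-darts⁺ (Adj-sym i u v (∈-darts⁻ (proj₁ (increasing⁻ e∈))))

  faceStep-dart : ∀ {d} → d ∈ darts R → f d ∈ darts R
  faceStep-dart {u , v} d∈ = ∈-darts⁺ (rot-adj v u (Adj-sym i u v (∈-darts⁻ d∈)))

  iter-faceStep-dart : ∀ k {d} → d ∈ darts R → iter f k d ∈ darts R
  iter-faceStep-dart zero    d∈ = d∈
  iter-faceStep-dart (suc k) d∈ = faceStep-dart (iter-faceStep-dart k d∈)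

  key-injective : ∀ {d e} → key R d ≡ key R e → d ≡ e
  key-injective {u , v} {u′ , v′} eq = begin
    (u , v)                       ≡⟨ remQuot-combine u v ⟨
    remQuot p (combine u v)       ≡⟨ cong (remQuot p) (toℕ-injective combine≡) ⟩
    remQuot p (combine u′ v′)     ≡⟨ remQuot-combine u′ v′ ⟩
    (u′ , v′)                     ∎
    where
    open ≡-Reasoning
    toℕ-combine′ : ∀ (x y : Fin p) → toℕ (combine x y) ≡ key R (x , y)
    toℕ-combine′ x y = trans (toℕ-combine x y) (cong (_+ toℕ y) (*-comm p (toℕ x)))
    combine≡ : toℕ (combine u v) ≡ toℕ (combine u′ v′)
    combine≡ = trans (toℕ-combine′ u v) (trans eq (sym (toℕ-combine′ u′ v′)))

  FacesOfLength : ℕ → Set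
  FacesOfLength n = ∀ {d} → d ∈ darts R → iter f n d ≡ d × (∀ j → 0 < j → j < n → iter f j d ≢ d)

  quadrangular⇒facesOfLength4 : Quadrangular R → FacesOfLength 4
  quadrangular⇒facesOfLength4 Q {u , v} d∈ with Q u v (∈-darts⁻ d∈)
  ... | closes , one , two , three = closes , shorter
    where
    shorter : ∀ j → 0 < j → j < 4 → iter f j (u , v) ≢ (u , v)
    shorter 1 _ _ = one
    shorter 2 _ _ = two
    shorter 3 _ _ = three
    shorter (suc (suc (suc (suc j)))) _ (s≤s (s≤s (s≤s (s≤s ()))))

  -- The face representatives chosen by isRep are the darts of least key on
  -- their face, so (k , r) ↦ f^k r is a bijection from [0, n) × reps to the darts.
  module _ {n : ℕ} .{{_ : NonZero n}} (n≤p*p : n ≤ p * p) (faces : FacesOfLength n) where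

    private
      closes : ∀ {d} → d ∈ darts R → iter f n d ≡ d
      closes = proj₁ ∘ faces

      reps : List (Dart R)
      reps = filterᵇ (isRep R) (darts R)

      ∈-reps⁻ : ∀ {r} → r ∈ reps → r ∈ darts R × T (isRep R r)
      ∈-reps⁻ = ∈-filterᵇ⁻ (isRep R)

    isRep⇒key-minimal : ∀ {r} → r ∈ darts R → T (isRep R r) → ∀ k → key R r ≤ key R (iter f k r)
    isRep⇒key-minimal {r} r∈ t k = subst (λ d → key R r ≤ key R d) (sym (iter-% f (closes r∈) k))
      (≤ᵇ⇒≤ _ _ (All.lookup (All.all⁺ _ (upTo (p * p)) t) (∈-upTo⁺ (<-≤-trans (m%n<n k n) n≤p*p))))

    key-minimal⇒isRep : ∀ {r} → (∀ k → key R r ≤ key R (iter f k r)) → T (isRep R r)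
    key-minimal⇒isRep {r} minimal = All.all⁻ (λ k → key R r ≤ᵇ key R (iter f k r)) {xs = upTo (p * p)} (All.tabulate (λ {k} _ → ≤⇒≤ᵇ (minimal k)))

    reps-on-same-face : ∀ {r r′} k → r ∈ reps → r′ ∈ reps → iter f k r ≡ r′ → r ≡ r′
    reps-on-same-face {r} {r′} k r∈ r′∈ e = key-injective (≤-antisym r≤r′ r′≤r)
      where
      r≤r′ : key R r ≤ key R r′
      r≤r′ = subst (λ d → key R r ≤ key R d) e (isRep⇒key-minimal (proj₁ (∈-reps⁻ r∈)) (proj₂ (∈-reps⁻ r∈)) k)
      r′≤r : key R r′ ≤ key R r
      r′≤r = subst (λ d → key R r′ ≤ key R d)
        (trans (cong (iter f ((n ∸ 1) * k)) (sym e)) (iter-inverse f (closes (proj₁ (∈-reps⁻ r∈))) k))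
        (isRep⇒key-minimal (proj₁ (∈-reps⁻ r′∈)) (proj₂ (∈-reps⁻ r′∈)) ((n ∸ 1) * k))

    private
      strictly-earlier : ∀ {d a b} → d ∈ darts R → a < b → b < n → iter f a d ≢ iter f b d
      strictly-earlier {d} {a} {b} d∈ a<b b<n e =
        proj₂ (faces (iter-faceStep-dart a d∈)) (b ∸ a) (m<n⇒0<n∸m a<b) (≤-<-trans (m∸n≤m b a) b<n)
          (trans (sym (iter-+ f (b ∸ a) a d)) (trans (cong (λ j → iter f j d) (m∸n+n≡m (<⇒≤ a<b))) (sym e)))

    iter-injective : ∀ {d a b} → d ∈ darts R → a < n → b < n → iter f a d ≡ iter f b d → a ≡ b
    iter-injective {a = a} {b} d∈ a<n b<n e with <-cmp a b
    ... | tri< a<b _ _ = ⊥-elim (strictly-earlier d∈ a<b b<n e)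
    ... | tri≈ _ a≡b _ = a≡b
    ... | tri> _ _ b<a = ⊥-elim (strictly-earlier d∈ b<a a<n (sym e))

    private
      cells : List (ℕ × Dart R)
      cells = cartesianProduct (upTo n) reps

      trace : ℕ × Dart R → Dart R
      trace (k , r) = iter f k r

      ∈-cells⁻ : ∀ {k r} → (k , r) ∈ cells → k < n × r ∈ reps
      ∈-cells⁻ c∈ with ∈-cartesianProduct⁻ (upTo n) reps c∈
      ... | k∈ , r∈ = ∈-upTo⁻ k∈ , r∈

      trace-injective : ∀ {c c′} → c ∈ cells → c′ ∈ cells → trace c ≡ trace c′ → c ≡ c′
      trace-injective {a , r} {b , r′} c∈ c′∈ e with ∈-cells⁻ c∈ | ∈-cells⁻ c′∈
      ... | a<n , r∈ | b<n , r′∈ with reps-on-same-face ((n ∸ 1) * b + a) r∈ r′∈ r′≡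
        where
        r′≡ : iter f ((n ∸ 1) * b + a) r ≡ r′
        r′≡ = trans (iter-+ f ((n ∸ 1) * b) a r)
                (trans (cong (iter f ((n ∸ 1) * b)) e) (iter-inverse f (closes (proj₁ (∈-reps⁻ r′∈))) b))
      ... | refl = cong (_, r) (iter-injective (proj₁ (∈-reps⁻ r∈)) a<n b<n e)

      face-of : Dart R → List (Dart R)
      face-of d = map (λ k → iter f k d) (upTo n)

      trace-into : ∀ {d} → d ∈ map trace cells → d ∈ darts R
      trace-into d∈ with ∈-map⁻ trace d∈
      ... | (k , r) , c∈ , refl = iter-faceStep-dart k (proj₁ (∈-reps⁻ (proj₂ (∈-cells⁻ c∈))))

      trace-onto : ∀ {d} → d ∈ darts R → d ∈ map trace cells
      trace-onto {d} d∈ with argmin-all (key R) {P = λ x → ∃[ j ] j < n × iter f j d ≡ x}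
                                       (0 , n>0 , refl) (All.tabulate on-face)
        where
        n>0 : 0 < n
        n>0 = >-nonZero⁻¹ n
        on-face : ∀ {x} → x ∈ face-of d → ∃[ j ] j < n × iter f j d ≡ x
        on-face x∈ with ∈-map⁻ _ x∈
        ... | j , j∈ , refl = j , ∈-upTo⁻ j∈ , refl
      ... | j , j<n , r≡ = subst (_∈ map trace cells) d≡ (∈-map⁺ trace (∈-cartesianProduct⁺ (∈-upTo⁺ (m%n<n _ n)) r∈reps))
        where
        r : Dart R
        r = argmin (key R) d (face-of d)
        r∈ : r ∈ darts R
        r∈ = subst (_∈ darts R) r≡ (iter-faceStep-dart j d∈)
        r-minimal : ∀ k → key R r ≤ key R (iter f k r)
        r-minimal k = subst (λ x → key R r ≤ key R x) (sym shift)
          (All.lookup (f[argmin]≤f[xs] {f = key R} d (face-of d)) (∈-map⁺ _ (∈-upTo⁺ (m%n<n (k + j) n))))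
          where
          shift : iter f k r ≡ iter f ((k + j) % n) d
          shift = trans (cong (iter f k) (sym r≡)) (trans (sym (iter-+ f k j d)) (iter-% f (closes d∈) (k + j)))
        r∈reps : r ∈ reps
        r∈reps = ∈-filterᵇ⁺ (isRep R) r∈ (key-minimal⇒isRep r-minimal)
        d≡ : iter f (((n ∸ 1) * j) % n) r ≡ d
        d≡ = trans (sym (iter-% f (closes r∈) ((n ∸ 1) * j)))
                   (trans (cong (iter f ((n ∸ 1) * j)) (sym r≡)) (iter-inverse f (closes d∈) j))

    length-darts-faces : length (darts R) ≡ n * numFaces R
    length-darts-faces = begin
      length (darts R)              ≡⟨ same-members⇒same-length darts-unique trace-unique trace-onto trace-into ⟩
      length (map trace cells)       ≡⟨ length-map trace cells ⟩
      length cells                  ≡⟨ length-cartesianProduct (upTo n) reps ⟩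
      length (upTo n) * length reps ≡⟨ cong (_* length reps) (length-upTo n) ⟩
      n * numFaces R                ∎
      where
      open ≡-Reasoning
      trace-unique : Unique (map trace cells)
      trace-unique = Unique-map⁺ trace (Unique.cartesianProduct⁺ (Unique.upTo⁺ n) (Unique-filterᵇ⁺ (isRep R) darts-unique)) trace-injective

  -- Euler's formula V - E + F = 2 - 2h, multiplied by 4 and using 4F = 2E = #darts.
  quadrangular⇒genus : Quadrangular R → 4 ≤ p * p → ∀ h → 4 * p + 8 * h ≡ length (darts R) + 8 → HasGenus R h
  quadrangular⇒genus Q 4≤p*p h count = *-cancelˡ-≡ _ _ 4 (begin
    4 * (p + F + 2 * h)     ≡⟨ solve 3 (λ p F h → con 4 :* (p :+ F :+ con 2 :* h) := (con 4 :* p :+ con 8 :* h) :+ con 4 :* F) refl p F h ⟩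
    (4 * p + 8 * h) + 4 * F ≡⟨ cong₂ _+_ count (sym (length-darts-faces 4≤p*p (quadrangular⇒facesOfLength4 Q))) ⟩
    (D + 8) + D             ≡⟨ cong (λ x → (x + 8) + x) length-darts-edges ⟩
    (2 * E + 8) + 2 * E     ≡⟨ solve 1 (λ E → (con 2 :* E :+ con 8) :+ con 2 :* E := con 4 :* (E :+ con 2)) refl E ⟩
    4 * (E + 2)             ∎)
    where
    open ≡-Reasoning
    F E D : ℕ
    F = numFaces R
    E = numEdges R
    D = length (darts R)

-- Rotation systems given on ℕ

faceStepℕ : (ℕ → ℕ → ℕ) → ℕ × ℕ → ℕ × ℕ
faceStepℕ r (x , y) = (y , r y x)

+-preserves-≢ : ∀ i {j k} → j ≢ k → i + j ≢ i + k
+-preserves-≢ i j≢k e = j≢k (+-cancelˡ-≡ i _ _ e)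

fresh-vertex : ∀ i a b → ∃[ j ] j < 3 × i + j ≢ a × i + j ≢ b
fresh-vertex i a b with i + 0 ≟ a | i + 0 ≟ b
... | no ≢a | no ≢b = 0 , s≤s z≤n , ≢a , ≢b
... | yes ≡a | _ with i + 1 ≟ b
...   | no ≢b  = 1 , s≤s (s≤s z≤n) , (λ e → +-preserves-≢ i {1} {0} (λ ()) (trans e (sym ≡a))) , ≢b
...   | yes ≡b = 2 , s≤s (s≤s (s≤s z≤n)) , (λ e → +-preserves-≢ i {2} {0} (λ ()) (trans e (sym ≡a)))
                                          , (λ e → +-preserves-≢ i {2} {1} (λ ()) (trans e (sym ≡b)))
fresh-vertex i a b | no ≢a | yes ≡b with i + 1 ≟ a
...   | no ≢a′ = 1 , s≤s (s≤s z≤n) , ≢a′ , (λ e → +-preserves-≢ i {1} {0} (λ ()) (trans e (sym ≡b)))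
...   | yes ≡a = 2 , s≤s (s≤s (s≤s z≤n)) , (λ e → +-preserves-≢ i {2} {1} (λ ()) (trans e (sym ≡a)))
                                          , (λ e → +-preserves-≢ i {2} {0} (λ ()) (trans e (sym ≡b)))

module _ {p i : ℕ} (r : ℕ → ℕ → ℕ) (r<p : ∀ x y → r x y < p)
  (r-adj : ∀ {x y} → x < p → y < p → Adjℕ i x y → Adjℕ i x (r x y))
  (r-cyclic : ∀ {x y z} → x < p → y < p → z < p → Adjℕ i x y → Adjℕ i x z → ∃[ k ] iter (r x) k y ≡ z) where

  private
    rot : Fin p → Fin p → Fin p
    rot v u = fromℕ< (r<p (toℕ v) (toℕ u))

    toℕ-iter-rot : ∀ v u k → toℕ (iter (rot v) k u) ≡ iter (r (toℕ v)) k (toℕ u)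
    toℕ-iter-rot v u zero    = refl
    toℕ-iter-rot v u (suc k) = trans (toℕ-fromℕ< _) (cong (r (toℕ v)) (toℕ-iter-rot v u k))

  rotationSystemℕ : RotationSystem p i
  rotationSystemℕ = record
    { rot        = rot
    ; rot-adj    = λ v u vu → Equivalence.from Adj⇔Adjℕ
                     (subst (Adjℕ i (toℕ v)) (sym (toℕ-fromℕ< _)) (r-adj (toℕ<n v) (toℕ<n u) (Equivalence.to Adj⇔Adjℕ vu)))
    ; rot-cyclic = λ v u w vu vw → cyclic v u w (Equivalence.to Adj⇔Adjℕ vu) (Equivalence.to Adj⇔Adjℕ vw)
    }
    where
    cyclic : ∀ v u w → Adjℕ i (toℕ v) (toℕ u) → Adjℕ i (toℕ v) (toℕ w) → ∃[ k ] iter (rot v) k u ≡ w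
    cyclic v u w vu vw with r-cyclic (toℕ<n v) (toℕ<n u) (toℕ<n w) vu vw
    ... | k , e = k , toℕ-injective (trans (toℕ-iter-rot v u k) e)

  quadrangularℕ : 3 + i ≤ p → (∀ {x y} → x < p → y < p → Adjℕ i x y → iter (faceStepℕ r) 4 (x , y) ≡ (x , y)) →
                  Quadrangular rotationSystemℕ
  quadrangularℕ room closesℕ = period4⇒quadrangular rotationSystemℕ period4 other-neighbour
    where
    toℕ² : Dart rotationSystemℕ → ℕ × ℕ
    toℕ² (u , v) = (toℕ u , toℕ v)
    toℕ²-iter : ∀ k d → toℕ² (iter (faceStep rotationSystemℕ) k d) ≡ iter (faceStepℕ r) k (toℕ² d)
    toℕ²-iter zero    d = refl
    toℕ²-iter (suc k) d = trans (cong₂ _,_ refl (toℕ-fromℕ< _)) (cong (faceStepℕ r) (toℕ²-iter k d))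
    toℕ²-injective : ∀ {d e} → toℕ² d ≡ toℕ² e → d ≡ e
    toℕ²-injective {u , v} {u′ , v′} e = cong₂ _,_ (toℕ-injective (cong proj₁ e)) (toℕ-injective (cong proj₂ e))
    period4 : ∀ u v → Adj i u v → iter (faceStep rotationSystemℕ) 4 (u , v) ≡ (u , v)
    period4 u v uv = toℕ²-injective (trans (toℕ²-iter 4 (u , v)) (closesℕ (toℕ<n u) (toℕ<n v) (Equivalence.to Adj⇔Adjℕ uv)))
    other-neighbour : ∀ v u → Adj i v u → ∃[ w ] Adj i v w × w ≢ u
    other-neighbour v u _ with fresh-vertex i (toℕ v) (toℕ u)
    ... | j , j<3 , ≢v , ≢u = w , Equivalence.from Adj⇔Adjℕ (v≢w , λ (_ , w<i)  → m+n≮m i j (subst (_< i) toℕ-w w<i))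
                                , (λ w≡u → ≢u (trans (sym toℕ-w) (cong toℕ w≡u)))
      where
      w : Fin p
      w = fromℕ< (<-≤-trans (+-monoʳ-< i j<3) (subst (_≤ p) (+-comm 3 i) room))
      toℕ-w : toℕ w ≡ i + j
      toℕ-w = toℕ-fromℕ< _
      v≢w : toℕ v ≢ toℕ w
      v≢w e = ≢v (sym (trans e toℕ-w))

-- The construction for s = n + 1

module Construction (n : ℕ) where

  h : ℕ
  h = suc n + suc n

  q : ℕ
  q = h + h

  m : ℕ
  m = 3 + (q + q)

  infix 4 _≈_
  infixl 7 _⊕_

  -- Kept opaque so that their arguments can be inferred.
  opaque
    _≈_ : ℕ → ℕ → Set
    a ≈ b = a % m ≡ b % m

    _⊕_ : ℕ → ℕ → ℕ
    z ⊕ a = (z + a) % m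

    ≈-refl : ∀ {a} → a ≈ a
    ≈-refl = refl

    ≈-trans : ∀ {a b c} → a ≈ b → b ≈ c → a ≈ c
    ≈-trans = trans

    ≡⇒≈ : ∀ {a b} → a ≡ b → a ≈ b
    ≡⇒≈ = cong (_% m)

    m≈0 : m ≈ 0
    m≈0 = n%n≡0 m

    m+m≈0 : m + m ≈ 0
    m+m≈0 = trans ([m+n]%n≡m%n m m) m≈0

    private
      ≈-+ : ∀ a b c d → a ≈ b → c ≈ d → a + c ≈ b + d
      ≈-+ a b c d a≈b c≈d = begin
        (a + c) % m               ≡⟨ %-distribˡ-+ a c m ⟩
        (a % m + c % m) % m       ≡⟨ cong₂ (λ x y → (x + y) % m) a≈b c≈d ⟩
        (b % m + d % m) % m       ≡⟨ %-distribˡ-+ b d m ⟨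
        (b + d) % m               ∎
        where open ≡-Reasoning

      %-≈ : ∀ a → a % m ≈ a
      %-≈ a = m%n%n≡m%n a m

      ≈⇒≡ : ∀ {a b} → a < m → b < m → a ≈ b → a ≡ b
      ≈⇒≡ a<m b<m a≈b = trans (sym (m<n⇒m%n≡m a<m)) (trans a≈b (m<n⇒m%n≡m b<m))

      ≈-cancelʳ : ∀ a b c → a + c ≈ b + c → a ≈ b
      ≈-cancelʳ a b c e = begin
        a % m                      ≡⟨ [m+n]%n≡m%n a m ⟨
        (a + m) % m                ≡⟨ cong (λ x → (a + x) % m) (m+[n∸m]≡n c′≤m) ⟨
        (a + (c′ + (m ∸ c′))) % m  ≡⟨ cong (_% m) (+-assoc a c′ (m ∸ c′)) ⟨
        (a + c′ + (m ∸ c′)) % m    ≡⟨ ≈-+ (a + c′) (b + c′) (m ∸ c′) (m ∸ c′) shifted refl ⟩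
        (b + c′ + (m ∸ c′)) % m    ≡⟨ cong (_% m) (+-assoc b c′ (m ∸ c′)) ⟩
        (b + (c′ + (m ∸ c′))) % m  ≡⟨ cong (λ x → (b + x) % m) (m+[n∸m]≡n c′≤m) ⟩
        (b + m) % m                ≡⟨ [m+n]%n≡m%n b m ⟩
        b % m                      ∎
        where
        open ≡-Reasoning
        c′ : ℕ
        c′ = c % m
        c′≤m : c′ ≤ m
        c′≤m = <⇒≤ (m%n<n c m)
        shifted : a + c′ ≈ b + c′
        shifted = trans (≈-+ a a c′ c refl (%-≈ c)) (trans e (≈-+ b b c c′ refl (sym (%-≈ c))))

    ⊕-< : ∀ z a → z ⊕ a < m
    ⊕-< z a = m%n<n (z + a) m

    ⊕-assoc : ∀ z a b → z ⊕ a ⊕ b ≡ z ⊕ (a + b)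
    ⊕-assoc z a b = trans (≈-+ ((z + a) % m) (z + a) b b (%-≈ (z + a)) refl) (cong (_% m) (+-assoc z a b))

    ⊕-identity : ∀ {z a} → z < m → a ≈ 0 → z ⊕ a ≡ z
    ⊕-identity {z} {a} z<m a≈0 = trans (≈-+ z z a 0 refl a≈0) (trans (cong (_% m) (+-identityʳ z)) (m<n⇒m%n≡m z<m))

    ⊕-multiple : ∀ z a t → z ⊕ (a + t * m) ≡ z ⊕ a
    ⊕-multiple z a t = trans (cong (_% m) (sym (+-assoc z a (t * m)))) ([m+kn]%n≡m%n (z + a) t m)

    ⊕-cancel : ∀ {z v} → z < m → v < m → z ⊕ v ⊕ (m ∸ z) ≡ v
    ⊕-cancel {z} {v} z<m v<m = begin
      (z ⊕ v + (m ∸ z)) % m    ≡⟨ ⊕-assoc z v (m ∸ z) ⟩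
      (z + (v + (m ∸ z))) % m  ≡⟨ cong (_% m) (solve 3 (λ z v x → z :+ (v :+ x) := v :+ (z :+ x)) refl z v (m ∸ z)) ⟩
      (v + (z + (m ∸ z))) % m  ≡⟨ cong (λ x → (v + x) % m) (m+[n∸m]≡n (<⇒≤ z<m)) ⟩
      (v + m) % m              ≡⟨ [m+n]%n≡m%n v m ⟩
      v % m                    ≡⟨ m<n⇒m%n≡m v<m ⟩
      v                        ∎
      where open ≡-Reasoning

    ⊕-difference : ∀ {z w} → z < m → w < m → z ⊕ (w ⊕ (m ∸ z)) ≡ w
    ⊕-difference {z} {w} z<m w<m = begin
      (z + (w ⊕ (m ∸ z))) % m  ≡⟨ ≈-+ z z (w ⊕ (m ∸ z)) (w + (m ∸ z)) refl (%-≈ (w + (m ∸ z))) ⟩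
      (z + (w + (m ∸ z))) % m  ≡⟨ cong (_% m) (solve 3 (λ z w x → z :+ (w :+ x) := w :+ (z :+ x)) refl z w (m ∸ z)) ⟩
      (w + (z + (m ∸ z))) % m  ≡⟨ cong (λ x → (w + x) % m) (m+[n∸m]≡n (<⇒≤ z<m)) ⟩
      (w + m) % m              ≡⟨ [m+n]%n≡m%n w m ⟩
      w % m                    ≡⟨ m<n⇒m%n≡m w<m ⟩
      w                        ∎
      where open ≡-Reasoning

    ⊕-reach : ∀ {z w} → z < m → w < m → z ⊕ ((m ∸ z) + w) ≡ w
    ⊕-reach {z} {w} z<m w<m = trans (cong (z ⊕_) (+-comm (m ∸ z) w)) (begin
      (z + (w + (m ∸ z))) % m  ≡⟨ cong (_% m) (solve 3 (λ z w x → z :+ (w :+ x) := w :+ (z :+ x)) refl z w (m ∸ z)) ⟩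
      (w + (z + (m ∸ z))) % m  ≡⟨ cong (λ x → (w + x) % m) (m+[n∸m]≡n (<⇒≤ z<m)) ⟩
      (w + m) % m              ≡⟨ [m+n]%n≡m%n w m ⟩
      w % m                    ≡⟨ m<n⇒m%n≡m w<m ⟩
      w                        ∎)
      where open ≡-Reasoning

    ⊕-inverse : ∀ z {v} → 1 ≤ v → v < m → z ⊕ (m ∸ (z ⊕ v)) ≡ m ∸ v
    ⊕-inverse z {v} 1≤v v<m = ≈⇒≡ (⊕-< z (m ∸ (z ⊕ v))) (∸-monoʳ-< {m} {v} {0} 1≤v (<⇒≤ v<m)) (≈-cancelʳ (z ⊕ (m ∸ r)) (m ∸ v) v (begin
      (z ⊕ (m ∸ r) + v) % m        ≡⟨ ≈-+ (z ⊕ (m ∸ r)) (z + (m ∸ r)) v v (%-≈ (z + (m ∸ r))) refl ⟩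
      (z + (m ∸ r) + v) % m        ≡⟨ cong (_% m) (solve 3 (λ z x v → z :+ x :+ v := (z :+ v) :+ x) refl z (m ∸ r) v) ⟩
      (z + v + (m ∸ r)) % m        ≡⟨ ≈-+ (z + v) r (m ∸ r) (m ∸ r) (sym (%-≈ (z + v))) refl ⟩
      (r + (m ∸ r)) % m            ≡⟨ cong (_% m) (trans (m+[n∸m]≡n (<⇒≤ (⊕-< z v))) (sym (m∸n+n≡m (<⇒≤ v<m)))) ⟩
      (m ∸ v + v) % m              ∎))
      where
      open ≡-Reasoning
      r : ℕ
      r = z ⊕ v

    ⊕-moves : ∀ {z v} → z < m → 1 ≤ v → v < m → z ⊕ v ≢ z
    ⊕-moves {z} {v} z<m 1≤v v<m e = <-irrefl (sym v≡0) 1≤v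
      where
      v≡0 : v ≡ 0
      v≡0 = ≈⇒≡ v<m (s≤s z≤n) (≈-cancelʳ v 0 z (trans (cong (_% m) (+-comm v z)) (trans e (sym (m<n⇒m%n≡m z<m)))))

  ⊕-closes₃ : ∀ {z a b c} → z < m → a + b + c ≈ 0 → z ⊕ a ⊕ b ⊕ c ≡ z
  ⊕-closes₃ {z} {a} {b} {c} z<m sum = begin
    z ⊕ a ⊕ b ⊕ c      ≡⟨ cong (_⊕ c) (⊕-assoc z a b) ⟩
    z ⊕ (a + b) ⊕ c    ≡⟨ ⊕-assoc z (a + b) c ⟩
    z ⊕ (a + b + c)    ≡⟨ ⊕-identity z<m sum ⟩
    z                  ∎
    where open ≡-Reasoning

  ⊕-closes₄ : ∀ {z a b c d} → z < m → a + b + c + d ≈ 0 → z ⊕ a ⊕ b ⊕ c ⊕ d ≡ z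
  ⊕-closes₄ {z} {a} {b} {c} {d} z<m sum = begin
    z ⊕ a ⊕ b ⊕ c ⊕ d      ≡⟨ cong (λ x → x ⊕ c ⊕ d) (⊕-assoc z a b) ⟩
    z ⊕ (a + b) ⊕ c ⊕ d    ≡⟨ cong (_⊕ d) (⊕-assoc z (a + b) c) ⟩
    z ⊕ (a + b + c) ⊕ d    ≡⟨ ⊕-assoc z (a + b + c) d ⟩
    z ⊕ (a + b + c + d)    ≡⟨ ⊕-identity z<m sum ⟩
    z                      ∎
    where open ≡-Reasoning

  last : ℕ
  last = n + suc n

  q≡ : q ≡ 2 + (last + last)
  q≡ = cong suc (+-suc last last)

  pred-q≡ : pred q ≡ suc (last + last)
  pred-q≡ = +-suc last last

  even-q : T (even q)
  even-q = even-double h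

  odd-pred-q : ¬ T (even (pred q))
  odd-pred-q = subst (¬_ ∘ T ∘ even) (sym pred-q≡) (odd-double last)

  odd-last : ¬ T (even last)
  odd-last = subst (¬_ ∘ T ∘ even) (sym (+-suc n n)) (odd-double n)

  m∸suc-q≡ : m ∸ suc q ≡ 2 + q
  m∸suc-q≡ = trans (cong (_∸ suc q) (solve 1 (λ q → con 3 :+ (q :+ q) := (con 2 :+ q) :+ (con 1 :+ q)) refl q))
                   (m+n∸n≡m (2 + q) (suc q))

  m∸pred-q≡ : m ∸ pred q ≡ 4 + q
  m∸pred-q≡ = trans (cong (_∸ pred q) (solve 1 (λ r → con 3 :+ ((con 1 :+ r) :+ (con 1 :+ r)) := (con 4 :+ (con 1 :+ r)) :+ r) refl (pred q)))
                    (m+n∸n≡m (4 + q) (pred q))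

  suc-q<m : suc q < m
  suc-q<m = s≤s (s≤s (≤-trans (m≤m+n q q) (n≤1+n (q + q))))

  -- The neighbours of a residue z are the triangle vertices u₀ u₁ u₂ and the
  -- residues z + a (plus a) and z - a (minus a) for 1 ≤ a ≤ q + 1.
  data Symbol : Set where
    u₀ u₁ u₂   : Symbol
    plus minus : ℕ → Symbol

  Proper : Symbol → Set
  Proper (plus a)  = 1 ≤ a × a ≤ suc q
  Proper (minus a) = 1 ≤ a × a ≤ suc q
  Proper _         = ⊥

  Valid : Symbol → Set
  Valid (plus a)  = Proper (plus a)
  Valid (minus a) = Proper (minus a)
  Valid _         = ⊤

  proper⇒valid : ∀ {d} → Proper d → Valid d
  proper⇒valid {plus _}  pd = pd
  proper⇒valid {minus _} pd = pd

  reverse : Symbol → Symbol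
  reverse (plus a)  = minus a
  reverse (minus a) = plus a
  reverse d         = d

  current : Symbol → ℕ
  current (plus a)  = a
  current (minus a) = m ∸ a
  current _         = 0

  triangle : ℕ → Symbol
  triangle 0 = u₀
  triangle 1 = u₁
  triangle _ = u₂

  -- The rotation at the triangle vertex c translates the residues by step c.
  step : ℕ → ℕ
  step 0 = 1
  step 1 = 1
  step _ = m ∸ 2

  -- σ is the common rotation at every residue, the single cycle
  --   u₀, +1, -4, +5, -8, …, -q, -(q+1), -(q-1), -(q-3), …, -1,
  --   -2, +3, -6, +7, …, +(q-1), u₂, +(q+1), u₁, +q, +(q-2), …, +2.
  σ : Symbol → Symbol
  σ u₀ = plus 1
  σ u₁ = plus q
  σ u₂ = plus (suc q)
  σ (plus a)  = if even a then plus-even a else plus-odd a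
    where
    plus-even : ℕ → Symbol
    plus-even (suc (suc a)) = if a ≡ᵇ 0 then u₀ else plus a
    plus-even _             = u₀
    plus-odd : ℕ → Symbol
    plus-odd a = if a ≡ᵇ pred q then u₂ else if a ≡ᵇ suc q then u₁ else minus (a + 3)
  σ (minus a) = if even a then minus-even a else minus-odd a
    where
    minus-even : ℕ → Symbol
    minus-even a = if a ≡ᵇ q then minus (suc q) else plus (suc a)
    minus-odd : ℕ → Symbol
    minus-odd (suc (suc a)) = minus a
    minus-odd _             = minus 2

  -- The dart after (z , d) in face tracing leaves z ⊕ current d along σ (reverse d).
  τ : Symbol → Symbol
  τ d = σ (reverse d)

  neighbour : ℕ → Symbol → ℕ
  neighbour z u₀        = 0
  neighbour z u₁        = 1
  neighbour z u₂        = 2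
  neighbour z (plus a)  = 3 + z ⊕ a
  neighbour z (minus a) = 3 + z ⊕ (m ∸ a)

  symbolOfCurrent : ℕ → Symbol
  symbolOfCurrent a = if a ≤ᵇ suc q then plus a else minus (m ∸ a)

  symbolOf : ℕ → ℕ → Symbol
  symbolOf z y = if y <ᵇ 3 then triangle y else symbolOfCurrent ((y ∸ 3) ⊕ (m ∸ z))

  neighbour-proper : ∀ {z d} → Proper d → neighbour z d ≡ 3 + z ⊕ current d
  neighbour-proper {d = plus _}  _ = refl
  neighbour-proper {d = minus _} _ = refl

  neighbour-triangle : ∀ {z c} → c < 3 → neighbour z (triangle c) ≡ c
  neighbour-triangle {c = 0} _ = refl
  neighbour-triangle {c = 1} _ = refl
  neighbour-triangle {c = 2} _ = refl
  neighbour-triangle {c = suc (suc (suc _))} (s≤s (s≤s (s≤s ())))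

  current-bounds : ∀ {d} → Proper d → 1 ≤ current d × current d < m
  current-bounds {plus a}  (1≤a , a≤) = 1≤a , ≤-trans (s≤s a≤) suc-q<m
  current-bounds {minus a} (1≤a , a≤) = m<n⇒0<n∸m a<m , ∸-monoʳ-< {m} {a} {0} 1≤a (<⇒≤ a<m)
    where
    a<m : a < m
    a<m = ≤-trans (s≤s a≤) suc-q<m

  reverse-proper : ∀ {d} → Proper d → Proper (reverse d)
  reverse-proper {plus _}  pd = pd
  reverse-proper {minus _} pd = pd

  current-reverse : ∀ {d} → Proper d → current (reverse d) ≡ m ∸ current d
  current-reverse {plus _}  _        = refl
  current-reverse {minus a} (_ , a≤) = sym (m∸[m∸n]≡n (≤-trans a≤ (<⇒≤ suc-q<m)))

  symbolOfCurrent-proper : ∀ {a} → 1 ≤ a → a < m → Proper (symbolOfCurrent a) × current (symbolOfCurrent a) ≡ a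
  symbolOfCurrent-proper {a} 1≤a a<m with a ≤? suc q
  ... | yes a≤ rewrite if-T {x = plus a} {minus (m ∸ a)} (≤⇒≤ᵇ a≤) = (1≤a , a≤) , refl
  ... | no  a≰ rewrite if-¬T {x = plus a} {minus (m ∸ a)} (a≰ ∘ ≤ᵇ⇒≤ a (suc q)) =
    (m<n⇒0<n∸m a<m , ≤-trans (∸-monoʳ-≤ m (≰⇒> a≰)) (≤-reflexive m∸2+q≡)) , m∸[m∸n]≡n (<⇒≤ a<m)
    where
    m∸2+q≡ : m ∸ (2 + q) ≡ suc q
    m∸2+q≡ = trans (cong (_∸ (2 + q)) (solve 1 (λ q → con 3 :+ (q :+ q) := (con 2 :+ q) :+ (con 1 :+ q)) refl q))
                   (m+n∸m≡n (2 + q) (suc q))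

  symbolOfCurrent-current : ∀ {d} → Proper d → symbolOfCurrent (current d) ≡ d
  symbolOfCurrent-current {plus a}  (_ , a≤) = if-T (≤⇒≤ᵇ a≤)
  symbolOfCurrent-current {minus a} (_ , a≤) = trans (if-¬T (λ t → <⇒≱ big (≤ᵇ⇒≤ _ _ t))) (cong minus (m∸[m∸n]≡n a≤m))
    where
    a≤m : a ≤ m
    a≤m = ≤-trans a≤ (<⇒≤ suc-q<m)
    big : suc q < m ∸ a
    big = ≤-trans (≤-reflexive (sym m∸suc-q≡)) (∸-monoʳ-≤ m a≤)

  symbolOfCurrent-reverse : ∀ {d} → Proper d → symbolOfCurrent (m ∸ current d) ≡ reverse d
  symbolOfCurrent-reverse pd = trans (cong symbolOfCurrent (sym (current-reverse pd))) (symbolOfCurrent-current (reverse-proper pd))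

  symbolOf-neighbour : ∀ {z c} → z < m → Valid c → symbolOf z (neighbour z c) ≡ c
  symbolOf-neighbour {c = u₀} _ _ = refl
  symbolOf-neighbour {c = u₁} _ _ = refl
  symbolOf-neighbour {c = u₂} _ _ = refl
  symbolOf-neighbour {z} {c@(plus a)}  z<m vc = trans (cong symbolOfCurrent (⊕-cancel z<m (proj₂ (current-bounds {c} vc)))) (symbolOfCurrent-current {c} vc)
  symbolOf-neighbour {z} {c@(minus a)} z<m vc = trans (cong symbolOfCurrent (⊕-cancel z<m (proj₂ (current-bounds {c} vc)))) (symbolOfCurrent-current {c} vc)

  symbolOf-back : ∀ {z d} → Proper d → symbolOf (z ⊕ current d) (3 + z) ≡ reverse d
  symbolOf-back {z} {d} pd = trans (cong symbolOfCurrent (⊕-inverse z (proj₁ (current-bounds pd)) (proj₂ (current-bounds pd))))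
                                   (symbolOfCurrent-reverse pd)

  neighbour-symbolOf : ∀ {z w} → z < m → w < m → w ≢ z → Proper (symbolOf z (3 + w)) × neighbour z (symbolOf z (3 + w)) ≡ 3 + w
  neighbour-symbolOf {z} {w} z<m w<m w≢z = proper , (begin
    neighbour z (symbolOfCurrent a)            ≡⟨ neighbour-proper proper ⟩
    3 + z ⊕ current (symbolOfCurrent a)        ≡⟨ cong (λ x → 3 + z ⊕ x) current≡ ⟩
    3 + z ⊕ a                                  ≡⟨ cong (3 +_) (⊕-difference z<m w<m) ⟩
    3 + w                                      ∎)
    where
    open ≡-Reasoning
    a : ℕ
    a = w ⊕ (m ∸ z)
    1≤a : 1 ≤ a
    1≤a = n≢0⇒n>0 (λ a≡0 → w≢z (trans (sym (⊕-difference z<m w<m)) (trans (cong (z ⊕_) a≡0) (⊕-identity z<m ≈-refl))))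
    proper : Proper (symbolOfCurrent a)
    proper = proj₁ (symbolOfCurrent-proper 1≤a (⊕-< w (m ∸ z)))
    current≡ : current (symbolOfCurrent a) ≡ a
    current≡ = proj₂ (symbolOfCurrent-proper 1≤a (⊕-< w (m ∸ z)))

  opaque
    rotℕ : ℕ → ℕ → ℕ
    rotℕ x y = if x <ᵇ 3 then 3 + (y ∸ 3) ⊕ step x else neighbour (x ∸ 3) (σ (symbolOf (x ∸ 3) y))

    rotℕ-triangle : ∀ {c} y → c < 3 → rotℕ c y ≡ 3 + (y ∸ 3) ⊕ step c
    rotℕ-triangle y c<3 = if-T (<⇒<ᵇ c<3)

    rotℕ-residue : ∀ z y → rotℕ (3 + z) y ≡ neighbour z (σ (symbolOf z y))
    rotℕ-residue z y = refl

  F : ℕ × ℕ → ℕ × ℕ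
  F = faceStepℕ rotℕ

  Closes : ℕ × ℕ → Set
  Closes d = iter F 4 d ≡ d

  walk : ∀ {z d e} → Proper d → τ d ≡ e → F (3 + z , neighbour z d) ≡ (3 + z ⊕ current d , neighbour (z ⊕ current d) e)
  walk {z} {d} {e} pd τd≡e = begin
    F (3 + z , neighbour z d)                              ≡⟨ cong (λ y → F (3 + z , y)) (neighbour-proper pd) ⟩
    (3 + z ⊕ v , rotℕ (3 + z ⊕ v) (3 + z))                 ≡⟨ cong (3 + z ⊕ v ,_) (rotℕ-residue (z ⊕ v) (3 + z)) ⟩
    (3 + z ⊕ v , neighbour (z ⊕ v) (σ (symbolOf (z ⊕ v) (3 + z))))
      ≡⟨ cong (λ s → (3 + z ⊕ v , neighbour (z ⊕ v) (σ s))) (symbolOf-back pd) ⟩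
    (3 + z ⊕ v , neighbour (z ⊕ v) (τ d))                  ≡⟨ cong (λ s → (3 + z ⊕ v , neighbour (z ⊕ v) s)) τd≡e ⟩
    (3 + z ⊕ v , neighbour (z ⊕ v) e)                      ∎
    where
    open ≡-Reasoning
    v : ℕ
    v = current d

  walk-into-triangle : ∀ {z c} → c < 3 → F (3 + z , c) ≡ (c , 3 + z ⊕ step c)
  walk-into-triangle {z} c<3 = cong (_ ,_) (rotℕ-triangle (3 + z) c<3)

  walk-out-of-triangle : ∀ {w c} → c < 3 → F (c , 3 + w) ≡ (3 + w , neighbour w (σ (triangle c)))
  walk-out-of-triangle {w} {c} c<3 = cong (3 + w ,_) (trans (rotℕ-residue w c) (cong (neighbour w ∘ σ) (if-T (<⇒<ᵇ c<3))))

  ≈0-rotate : ∀ a b c d → a + b + c + d ≈ 0 → b + c + d + a ≈ 0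
  ≈0-rotate a b c d = ≈-trans (≡⇒≈ (solve 4 (λ a b c d → b :+ c :+ d :+ a := a :+ b :+ c :+ d) refl a b c d))

  proper-face : ∀ {a b c d} → Proper a → Proper b → Proper c → Proper d →
    τ a ≡ b → τ b ≡ c → τ c ≡ d → τ d ≡ a → current a + current b + current c + current d ≈ 0 →
    ∀ {z} → z < m → Closes (3 + z , neighbour z a)
  proper-face {a} {b} {c} {d} pa pb pc pd ab bc cd da sum {z} z<m =
    iter-4-cycle {F = F} (walk {z} pa ab) (walk {z ⊕ current a} pb bc) (walk {z ⊕ current a ⊕ current b} pc cd)
      (trans (walk {z ⊕ current a ⊕ current b ⊕ current c} pd da) (cong (λ x → (3 + x , neighbour x a)) (⊕-closes₄ z<m sum)))

  module QuadFace (k : ℕ) (room : 4 + (k + k) ≤ q) where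

    y : ℕ
    y = 2 + (k + k)

    private
      p-y : Proper (plus y)
      p-y = s≤s z≤n , ≤-trans (≤-trans (n≤1+n _) (n≤1+n _)) (≤-trans room (n≤1+n q))
      p-y+1 : Proper (plus (suc y))
      p-y+1 = s≤s z≤n , ≤-trans (n≤1+n _) (≤-trans room (n≤1+n q))
      m-y-1 : Proper (minus (suc (k + k)))
      m-y-1 = s≤s z≤n , ≤-trans (n≤1+n _) (proj₂ p-y)
      m-y+2 : Proper (minus (2 + y))
      m-y+2 = s≤s z≤n , ≤-trans room (n≤1+n q)

      c₃ c₄ : ℕ
      c₃ = m ∸ suc (k + k)
      c₄ = m ∸ (2 + y)

      y-1<pred-q : suc (k + k) < pred q
      y-1<pred-q = ≤-trans (n≤1+n _) (≤-pred room)

    τ-plus-y : τ (plus y) ≡ plus (suc y)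
    τ-plus-y = trans (if-T (even-double k)) (if-¬T (λ t → <⇒≢ y<q (≡ᵇ⇒≡ y q t)))
      where
      y<q : y < q
      y<q = ≤-trans (n≤1+n _) room

    τ-plus-y+1 : τ (plus (suc y)) ≡ minus (suc (k + k))
    τ-plus-y+1 = if-¬T (odd-double k)

    τ-minus-y-1 : τ (minus (suc (k + k))) ≡ minus (2 + y)
    τ-minus-y-1 = trans (if-¬T (odd-double k))
      (trans (if-¬T (λ t → <⇒≢ y-1<pred-q (≡ᵇ⇒≡ _ _ t)))
      (trans (if-¬T (λ t → <⇒≢ (<-trans y-1<pred-q (n≤1+n q)) (≡ᵇ⇒≡ _ _ t)))
             (cong minus (+-comm (suc (k + k)) 3))))

    τ-minus-y+2 : τ (minus (2 + y)) ≡ plus y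
    τ-minus-y+2 = if-T (even-double k)

    currents : y + suc y + c₃ + c₄ ≈ 0
    currents = ≈-trans (≡⇒≈ (begin
      y + suc y + c₃ + c₄                                  ≡⟨ solve 3 (λ K c₃ c₄ → (con 2 :+ K) :+ (con 3 :+ K) :+ c₃ :+ c₄
                                                                := (c₃ :+ (con 1 :+ K)) :+ (c₄ :+ (con 4 :+ K))) refl (k + k) c₃ c₄ ⟩
      (c₃ + suc (k + k)) + (c₄ + (2 + y))                  ≡⟨ cong₂ _+_ (m∸n+n≡m (≤-trans (proj₂ m-y-1) (<⇒≤ suc-q<m)))
                                                                      (m∸n+n≡m (≤-trans (proj₂ m-y+2) (<⇒≤ suc-q<m))) ⟩
      m + m                                                ∎)) m+m≈0
      where open ≡-Reasoning

    private
      currents₁ : suc y + c₃ + c₄ + y ≈ 0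
      currents₁ = ≈0-rotate y (suc y) c₃ c₄ currents
      currents₂ : c₃ + c₄ + y + suc y ≈ 0
      currents₂ = ≈0-rotate (suc y) c₃ c₄ y currents₁
      currents₃ : c₄ + y + suc y + c₃ ≈ 0
      currents₃ = ≈0-rotate c₃ c₄ y (suc y) currents₂

    closes-plus-y : ∀ {z} → z < m → Closes (3 + z , neighbour z (plus y))
    closes-plus-y = proper-face p-y p-y+1 m-y-1 m-y+2 τ-plus-y τ-plus-y+1 τ-minus-y-1 τ-minus-y+2 currents

    closes-plus-y+1 : ∀ {z} → z < m → Closes (3 + z , neighbour z (plus (suc y)))
    closes-plus-y+1 = proper-face p-y+1 m-y-1 m-y+2 p-y τ-plus-y+1 τ-minus-y-1 τ-minus-y+2 τ-plus-y currents₁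

    closes-minus-y-1 : ∀ {z} → z < m → Closes (3 + z , neighbour z (minus (suc (k + k))))
    closes-minus-y-1 = proper-face m-y-1 m-y+2 p-y p-y+1 τ-minus-y-1 τ-minus-y+2 τ-plus-y τ-plus-y+1 currents₂

    closes-minus-y+2 : ∀ {z} → z < m → Closes (3 + z , neighbour z (minus (2 + y)))
    closes-minus-y+2 = proper-face m-y+2 p-y p-y+1 m-y-1 τ-minus-y+2 τ-plus-y τ-plus-y+1 τ-minus-y-1 currents₃

  ≈0-rotate₃ : ∀ a b c → a + b + c ≈ 0 → b + c + a ≈ 0
  ≈0-rotate₃ a b c = ≈-trans (≡⇒≈ (solve 3 (λ a b c → b :+ c :+ a := a :+ b :+ c) refl a b c))

  -- The faces through the triangle vertex c are (3 + z , b) → (3 + z ⊕ current b , f) → (… , c) → (c , …).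
  module TriangleFace {c : ℕ} (c<3 : c < 3) {b f : Symbol} (pb : Proper b) (pf : Proper f)
    (σc≡b : σ (triangle c) ≡ b) (τb≡f : τ b ≡ f) (τf≡c : τ f ≡ triangle c)
    (currents : current b + current f + step c ≈ 0) where

    private
      vb vf k : ℕ
      vb = current b
      vf = current f
      k  = step c

      from-b : ∀ {z} → F (3 + z , neighbour z b) ≡ (3 + z ⊕ vb , neighbour (z ⊕ vb) f)
      from-b {z} = walk {z} pb τb≡f

      from-f : ∀ {z} → F (3 + z , neighbour z f) ≡ (3 + z ⊕ vf , c)
      from-f {z} = trans (walk {z} pf τf≡c) (cong (3 + z ⊕ vf ,_) (neighbour-triangle c<3))

      enter : ∀ {z} → F (3 + z , c) ≡ (c , 3 + z ⊕ k)
      enter {z} = walk-into-triangle {z} c<3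

      leave : ∀ {w} → F (c , 3 + w) ≡ (3 + w , neighbour w b)
      leave {w} = trans (walk-out-of-triangle {w} c<3) (cong (λ s → (3 + w , neighbour w s)) σc≡b)

    closes-b : ∀ {z} → z < m → Closes (3 + z , neighbour z b)
    closes-b {z} z<m = iter-4-cycle {F = F} (from-b {z}) (from-f {z ⊕ vb}) (enter {z ⊕ vb ⊕ vf})
      (trans (leave {z ⊕ vb ⊕ vf ⊕ k}) (cong (λ x → (3 + x , neighbour x b)) (⊕-closes₃ z<m currents)))

    closes-f : ∀ {z} → z < m → Closes (3 + z , neighbour z f)
    closes-f {z} z<m = iter-4-cycle {F = F} (from-f {z}) (enter {z ⊕ vf}) (leave {z ⊕ vf ⊕ k})
      (trans (from-b {z ⊕ vf ⊕ k}) (cong (λ x → (3 + x , neighbour x f)) (⊕-closes₃ z<m (≈0-rotate₃ vb vf k currents))))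

    closes-c : ∀ {z} → z < m → Closes (3 + z , c)
    closes-c {z} z<m = iter-4-cycle {F = F} (enter {z}) (leave {z ⊕ k}) (from-b {z ⊕ k})
      (trans (from-f {z ⊕ k ⊕ vb}) (cong (λ x → (3 + x , c)) (⊕-closes₃ z<m (≈0-rotate₃ vf k vb (≈0-rotate₃ vb vf k currents)))))

    closes-out : ∀ {w} → w < m → Closes (c , 3 + w)
    closes-out {w} w<m = iter-4-cycle {F = F} (leave {w}) (from-b {w}) (from-f {w ⊕ vb})
      (trans (enter {w ⊕ vb ⊕ vf}) (cong (λ x → (c , 3 + x)) (⊕-closes₃ w<m currents)))

  pred-q≢suc-q : pred q ≢ suc q
  pred-q≢suc-q e = <-irrefl e (n≤1+n q)

  σ-minus-q : σ (minus q) ≡ minus (suc q)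
  σ-minus-q = trans (if-T even-q) (if-T (≡⇒≡ᵇ q q refl))

  σ-plus-suc-q : σ (plus (suc q)) ≡ u₁
  σ-plus-suc-q = trans (if-¬T odd-pred-q) (trans (if-¬T (λ t → pred-q≢suc-q (sym (≡ᵇ⇒≡ _ _ t)))) (if-T (≡⇒≡ᵇ (suc q) (suc q) refl)))

  σ-minus-suc-q : σ (minus (suc q)) ≡ minus (pred q)
  σ-minus-suc-q = if-¬T odd-pred-q

  σ-plus-pred-q : σ (plus (pred q)) ≡ u₂
  σ-plus-pred-q = trans (if-¬T odd-pred-q) (if-T (≡⇒≡ᵇ (pred q) (pred q) refl))

  module Triangle₀ = TriangleFace {0} (s≤s z≤n) {plus 1} {minus 2} (s≤s z≤n , s≤s z≤n) (s≤s z≤n , s≤s (s≤s z≤n)) refl refl refl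
    (≈-trans (≡⇒≈ (solve 1 (λ q → con 1 :+ (con 1 :+ (q :+ q)) :+ con 1 := con 3 :+ (q :+ q)) refl q)) m≈0)

  module Triangle₁ = TriangleFace {1} (s≤s (s≤s z≤n)) {plus q} {minus (suc q)} (s≤s z≤n , n≤1+n q) (s≤s z≤n , ≤-refl)
    refl σ-minus-q σ-plus-suc-q
    (≈-trans (≡⇒≈ (trans (cong (λ x → q + x + 1) m∸suc-q≡) (solve 1 (λ q → q :+ (con 2 :+ q) :+ con 1 := con 3 :+ (q :+ q)) refl q))) m≈0)

  module Triangle₂ = TriangleFace {2} (s≤s (s≤s (s≤s z≤n))) {plus (suc q)} {minus (pred q)} (s≤s z≤n , ≤-refl)
    (subst (1 ≤_) (sym pred-q≡) (s≤s z≤n) , ≤-trans (n≤1+n (pred q)) (n≤1+n q))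
    refl σ-minus-suc-q σ-plus-pred-q
    (≈-trans (≡⇒≈ (trans (cong (λ x → suc q + x + (m ∸ 2)) m∸pred-q≡)
                        (solve 1 (λ r → (con 1 :+ (con 1 :+ r)) :+ (con 4 :+ (con 1 :+ r)) :+ (con 1 :+ ((con 1 :+ r) :+ (con 1 :+ r)))
                                     := (con 3 :+ ((con 1 :+ r) :+ (con 1 :+ r))) :+ (con 3 :+ ((con 1 :+ r) :+ (con 1 :+ r)))) refl (pred q))))
             m+m≈0)

  private
    even≢suc-q : ∀ k → k + k ≢ suc q
    even≢suc-q k e = double≢odd k h e

    odd≢q : ∀ k → suc (k + k) ≢ q
    odd≢q k e = double≢odd h k (sym e)

    even<q : ∀ k → k + k ≤ suc q → k + k ≢ q → k + k < q
    even<q k le ne = ≤∧≢⇒< (≤-pred (≤∧≢⇒< le (even≢suc-q k))) ne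

    odd<pred-q : ∀ k → suc (k + k) ≤ suc q → suc (k + k) ≢ suc q → suc (k + k) ≢ pred q → 2 + (k + k) ≤ last + last
    odd<pred-q k le ne₁ ne₂ = double-<-step k last (≤-pred (subst (suc (suc (k + k)) ≤_) pred-q≡ t<pred-q))
      where
      t<pred-q : suc (k + k) < pred q
      t<pred-q = ≤∧≢⇒< (<⇒≤pred (≤∧≢⇒< (≤-pred (≤∧≢⇒< le ne₁)) (odd≢q k))) ne₂

  closes-proper : ∀ {z} d → z < m → Proper d → Closes (3 + z , neighbour z d)
  closes-proper {z} (plus a) z<m (1≤a , a≤) with even-or-odd a
  ... | inj₁ (zero , refl) = ⊥-elim (<-irrefl refl 1≤a)
  ... | inj₁ (suc k , refl) with suc k + suc k ≟ q
  ...   | yes a≡q = subst (λ a → Closes (3 + z , neighbour z (plus a))) (sym a≡q) (Triangle₁.closes-b z<m)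
  ...   | no  a≢q = subst (λ a → Closes (3 + z , neighbour z (plus a))) (sym (cong suc (+-suc k k)))
                      (QuadFace.closes-plus-y k room z<m)
    where
    room : 4 + (k + k) ≤ q
    room = subst (λ x → suc (suc x) ≤ q) (cong suc (+-suc k k)) (double-<-step (suc k) h (even<q (suc k) a≤ a≢q))
  closes-proper {z} (plus a) z<m (1≤a , a≤) | inj₂ (zero , refl) = Triangle₀.closes-b z<m
  closes-proper {z} (plus a) z<m (1≤a , a≤) | inj₂ (suc k , refl) with suc (suc k + suc k) ≟ suc q
  ...   | yes a≡ = subst (λ a → Closes (3 + z , neighbour z (plus a))) (sym a≡) (Triangle₂.closes-b z<m)
  ...   | no  a≢ = subst (λ a → Closes (3 + z , neighbour z (plus a))) (sym (cong (suc ∘ suc) (+-suc k k)))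
                     (QuadFace.closes-plus-y+1 k room z<m)
    where
    room : 4 + (k + k) ≤ q
    room = subst (λ x → suc (suc x) ≤ q) (cong suc (+-suc k k))
             (≤∧≢⇒< (≤-pred (≤∧≢⇒< a≤ a≢)) (odd≢q (suc k)))
  closes-proper {z} (minus t) z<m (1≤t , t≤) with even-or-odd t
  ... | inj₁ (zero , refl) = ⊥-elim (<-irrefl refl 1≤t)
  ... | inj₁ (suc zero , refl) = Triangle₀.closes-f z<m
  ... | inj₁ (suc (suc k) , refl) = subst (λ t → Closes (3 + z , neighbour z (minus t))) (sym t≡)
                                      (QuadFace.closes-minus-y+2 k room z<m)
    where
    t≡ : suc (suc k) + suc (suc k) ≡ 4 + (k + k)
    t≡ = solve 1 (λ k → (con 2 :+ k) :+ (con 2 :+ k) := con 4 :+ (k :+ k)) refl k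
    room : 4 + (k + k) ≤ q
    room = subst (_≤ q) t≡ (≤-pred (≤∧≢⇒< t≤ (even≢suc-q (suc (suc k)))))
  ... | inj₂ (k , refl) with suc (k + k) ≟ suc q | suc (k + k) ≟ pred q
  ...   | yes t≡ | _     = subst (λ t → Closes (3 + z , neighbour z (minus t))) (sym t≡) (Triangle₁.closes-f z<m)
  ...   | no _   | yes t≡ = subst (λ t → Closes (3 + z , neighbour z (minus t))) (sym t≡) (Triangle₂.closes-f z<m)
  ...   | no t≢₁ | no t≢₂ = QuadFace.closes-minus-y-1 k room z<m
    where
    room : 4 + (k + k) ≤ q
    room = subst (4 + (k + k) ≤_) (sym q≡) (s≤s (s≤s (odd<pred-q k t≤ t≢₁ t≢₂)))

  data VertexView : ℕ → Set where
    triangle-vertex : ∀ {c} → c < 3 → VertexView c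
    residue-vertex  : ∀ z → VertexView (3 + z)

  vertex-view : ∀ x → VertexView x
  vertex-view 0                   = triangle-vertex (s≤s z≤n)
  vertex-view 1                   = triangle-vertex (s≤s (s≤s z≤n))
  vertex-view 2                   = triangle-vertex (s≤s (s≤s (s≤s z≤n)))
  vertex-view (suc (suc (suc z))) = residue-vertex z

  closes-into-triangle : ∀ {c z} → c < 3 → z < m → Closes (3 + z , c)
  closes-into-triangle {0} _ = Triangle₀.closes-c
  closes-into-triangle {1} _ = Triangle₁.closes-c
  closes-into-triangle {2} _ = Triangle₂.closes-c
  closes-into-triangle {suc (suc (suc _))} (s≤s (s≤s (s≤s ())))

  closes-out-of-triangle : ∀ {c w} → c < 3 → w < m → Closes (c , 3 + w)
  closes-out-of-triangle {0} _ = Triangle₀.closes-out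
  closes-out-of-triangle {1} _ = Triangle₁.closes-out
  closes-out-of-triangle {2} _ = Triangle₂.closes-out
  closes-out-of-triangle {suc (suc (suc _))} (s≤s (s≤s (s≤s ())))

  closes : ∀ {x y} → x < 3 + m → y < 3 + m → Adjℕ 3 x y → Closes (x , y)
  closes {x} {y} x< y< (x≢y , ¬both) with vertex-view x | vertex-view y
  ... | triangle-vertex c<3 | triangle-vertex c′<3 = ⊥-elim (¬both (c<3 , c′<3))
  ... | triangle-vertex c<3 | residue-vertex w     = closes-out-of-triangle c<3 (≤-pred (≤-pred (≤-pred y<)))
  ... | residue-vertex z    | triangle-vertex c<3  = closes-into-triangle c<3 (≤-pred (≤-pred (≤-pred x<)))
  ... | residue-vertex z    | residue-vertex w     with neighbour-symbolOf {z} {w} z<m (≤-pred (≤-pred (≤-pred y<))) (λ w≡z → x≢y (cong (3 +_) (sym w≡z)))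
    where
    z<m : z < m
    z<m = ≤-pred (≤-pred (≤-pred x<))
  ...   | proper , neighbour≡ = subst (λ y → Closes (3 + z , y)) neighbour≡ (closes-proper _ (≤-pred (≤-pred (≤-pred x<))) proper)

  neighbour-< : ∀ z d → neighbour z d < 3 + m
  neighbour-< z u₀        = s≤s z≤n
  neighbour-< z u₁        = s≤s (s≤s z≤n)
  neighbour-< z u₂        = s≤s (s≤s (s≤s z≤n))
  neighbour-< z (plus a)  = +-monoʳ-< 3 (⊕-< z a)
  neighbour-< z (minus a) = +-monoʳ-< 3 (⊕-< z (m ∸ a))

  proper-≢ : ∀ {z d} → z < m → Proper d → neighbour z d ≢ 3 + z
  proper-≢ {z} {d} z<m pd e = ⊕-moves z<m (proj₁ (current-bounds {d} pd)) (proj₂ (current-bounds {d} pd))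
    (suc-injective (suc-injective (suc-injective (trans (sym (neighbour-proper {z} {d} pd)) e))))

  neighbour-≢ : ∀ {z d} → z < m → Valid d → neighbour z d ≢ 3 + z
  neighbour-≢ {d = u₀} _ _ ()
  neighbour-≢ {d = u₁} _ _ ()
  neighbour-≢ {d = u₂} _ _ ()
  neighbour-≢ {z} {d@(plus _)}  z<m vd = proper-≢ {z} {d} z<m vd
  neighbour-≢ {z} {d@(minus _)} z<m vd = proper-≢ {z} {d} z<m vd

  symbolOf-spec : ∀ {z y} → z < m → y < 3 + m → y ≢ 3 + z → Valid (symbolOf z y) × neighbour z (symbolOf z y) ≡ y
  symbolOf-spec {z} {y} z<m y< y≢ with vertex-view y
  ... | triangle-vertex {c} c<3 rewrite if-T {x = triangle c} {symbolOfCurrent ((c ∸ 3) ⊕ (m ∸ z))} (<⇒<ᵇ c<3) =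
    triangle-valid c , neighbour-triangle c<3
    where
    triangle-valid : ∀ c → Valid (triangle c)
    triangle-valid 0 = tt
    triangle-valid 1 = tt
    triangle-valid (suc (suc _)) = tt
  ... | residue-vertex w with neighbour-symbolOf {z} {w} z<m (≤-pred (≤-pred (≤-pred y<))) (λ w≡z → y≢ (cong (3 +_) w≡z))
  ...   | proper , neighbour≡ = proper⇒valid proper , neighbour≡

  private
    ≤suc-q⇒≤q : ∀ k → k + k ≤ suc q → k + k ≤ q
    ≤suc-q⇒≤q k le = ≤-pred (≤∧≢⇒< le (even≢suc-q k))

  σ-valid-plus-even : ∀ k → 2 + (k + k) ≤ suc q → Valid (σ (plus (2 + (k + k))))
  σ-valid-plus-even k a≤ = subst Valid (sym (if-T (even-double k)))
    (if-elim Valid (k + k ≡ᵇ 0) (λ _ → tt)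
      (λ k+k≢0 → n≢0⇒n>0 (k+k≢0 ∘ ≡⇒≡ᵇ _ _) , ≤-trans (≤-trans (n≤1+n _) (n≤1+n _)) a≤))

  σ-valid-plus-odd : ∀ k → suc (k + k) ≤ suc q → Valid (σ (plus (suc (k + k))))
  σ-valid-plus-odd k a≤ = subst Valid (sym (if-¬T (odd-double k)))
    (if-elim Valid (suc (k + k) ≡ᵇ pred q) (λ _ → tt) λ ≢pred-q →
      if-elim Valid (suc (k + k) ≡ᵇ suc q) (λ _ → tt) λ ≢suc-q →
        subst (λ x → 1 ≤ x × x ≤ suc q) (+-comm 3 (suc (k + k))) (s≤s z≤n , room ≢suc-q ≢pred-q))
    where
    room : ¬ T (suc (k + k) ≡ᵇ suc q) → ¬ T (suc (k + k) ≡ᵇ pred q) → 4 + (k + k) ≤ suc q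
    room ≢suc-q ≢pred-q = subst (λ x → 4 + (k + k) ≤ suc x) (sym q≡)
      (s≤s (s≤s (≤-trans (odd<pred-q k a≤ (≢suc-q ∘ ≡⇒≡ᵇ _ _) (≢pred-q ∘ ≡⇒≡ᵇ _ _)) (n≤1+n _))))

  σ-valid : ∀ {c} → Valid c → Valid (σ c)
  σ-valid {u₀} _ = s≤s z≤n , s≤s z≤n
  σ-valid {u₁} _ = s≤s z≤n , n≤1+n q
  σ-valid {u₂} _ = s≤s z≤n , ≤-refl
  σ-valid {plus a} (1≤a , a≤) with even-or-odd a
  ... | inj₁ (zero , refl)  = ⊥-elim (<-irrefl refl 1≤a)
  ... | inj₁ (suc k , refl) = subst (Valid ∘ σ ∘ plus) (sym a≡) (σ-valid-plus-even k (subst (_≤ suc q) a≡ a≤))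
    where
    a≡ : suc k + suc k ≡ 2 + (k + k)
    a≡ = cong suc (+-suc k k)
  ... | inj₂ (k , refl) = σ-valid-plus-odd k a≤
  σ-valid {minus t} (1≤t , t≤) with even-or-odd t
  ... | inj₁ (k , refl) = subst Valid (sym (if-T (even-double k)))
    (if-elim Valid (k + k ≡ᵇ q) (λ _ → s≤s z≤n , ≤-refl)
      (λ t≢q → s≤s z≤n , ≤-trans (≤∧≢⇒< (≤suc-q⇒≤q k t≤) (t≢q ∘ ≡⇒≡ᵇ _ _)) (n≤1+n q)))
  ... | inj₂ (zero , refl)  = s≤s z≤n , s≤s (s≤s z≤n)
  ... | inj₂ (suc k , refl) = subst (Valid ∘ σ ∘ minus) (sym t≡) (subst Valid (sym (if-¬T (odd-double k)))
    (s≤s z≤n , ≤-trans (≤-trans (n≤1+n _) (n≤1+n _)) (subst (_≤ suc q) t≡ t≤)))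
    where
    t≡ : suc (suc k + suc k) ≡ 3 + (k + k)
    t≡ = cong (suc ∘ suc) (+-suc k k)

  iter-σ-valid : ∀ k {c} → Valid c → Valid (iter σ k c)
  iter-σ-valid zero    vc = vc
  iter-σ-valid (suc k) {c} vc = σ-valid {iter σ k c} (iter-σ-valid k {c} vc)

  infix 4 _↝_

  _↝_ : Symbol → Symbol → Set
  c ↝ c′ = ∃[ k ] iter σ k c ≡ c′

  ↝-refl : ∀ {c} → c ↝ c
  ↝-refl = 0 , refl

  ↝-trans : ∀ {c c′ c″} → c ↝ c′ → c′ ↝ c″ → c ↝ c″
  ↝-trans {c} (k , e) (k′ , e′) = k′ + k , trans (iter-+ σ k′ k c) (trans (cong (iter σ k′) e) e′)

  ↝-step : ∀ {c c′} → σ c ≡ c′ → c ↝ c′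
  ↝-step e = 1 , e

  along-run : (r : ℕ → Symbol) → (∀ k → suc k < h → σ (r k) ≡ r (suc k)) → ∀ {i j} → i ≤ j → j < h → r i ↝ r j
  along-run r step {i} i≤j j<h with m≤n⇒∃[o]m+o≡n i≤j
  ... | d , refl = go d j<h
    where
    go : ∀ d → i + d < h → r i ↝ r (i + d)
    go zero    _  = 0 , cong r (sym (+-identityʳ i))
    go (suc d) lt = ↝-trans (go d (<-trans (n<1+n _) lt′)) (↝-step (trans (step (i + d) lt′) (cong r (sym (+-suc i d)))))
      where
      lt′ : suc (i + d) < h
      lt′ = subst (_< h) (+-suc i d) lt

  -- The four runs of the cycle of σ displayed above σ.
  run₁ run₂ run₃ run₄ : ℕ → Symbol
  run₁ k = if even k then plus (suc (k + k)) else minus (2 + (k + k))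
  run₂ j = minus (q ∸ suc (j + j))
  run₃ k = if even k then minus (2 + (k + k)) else plus (suc (k + k))
  run₄ j = plus (q ∸ (j + j))

  private
    inside : ∀ {k} → suc k < h → 2 + (k + k) ≤ last + last
    inside {k} lt = double-<-step k last (+-mono-< k<last k<last)
      where
      k<last : k < last
      k<last = ≤-pred lt

    σ-plus-odd : ∀ {k} → suc k < h → σ (plus (suc (k + k))) ≡ minus (2 + (suc k + suc k))
    σ-plus-odd {k} lt = trans (if-¬T (odd-double k)) (trans (if-¬T (<⇒≢ below-pred-q ∘ ≡ᵇ⇒≡ _ _))
      (trans (if-¬T (<⇒≢ (<-trans below-pred-q (n≤1+n q)) ∘ ≡ᵇ⇒≡ _ _))
             (cong minus (solve 1 (λ k → con 1 :+ (k :+ k) :+ con 3 := con 2 :+ ((con 1 :+ k) :+ (con 1 :+ k))) refl k))))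
      where
      below-pred-q : suc (k + k) < pred q
      below-pred-q = subst (suc (suc (k + k)) ≤_) (sym pred-q≡) (≤-trans (inside lt) (n≤1+n _))

    σ-minus-even : ∀ {k} → suc k < h → σ (minus (2 + (k + k))) ≡ plus (suc (suc k + suc k))
    σ-minus-even {k} lt = trans (if-T (even-double k)) (trans (if-¬T (<⇒≢ below-q ∘ ≡ᵇ⇒≡ _ _))
      (cong (plus ∘ suc) (sym (cong suc (+-suc k k)))))
      where
      below-q : 2 + (k + k) < q
      below-q = subst (3 + (k + k) ≤_) (sym q≡) (s≤s (s≤s (≤-trans (n≤1+n _) (inside lt))))

    halves : ∀ {j} → suc j < h → ∃[ d ] q ≡ (2 + j + d) + (2 + j + d)
    halves lt with m≤n⇒∃[o]m+o≡n lt
    ... | d , e = d , cong₂ _+_ (sym e) (sym e)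

  run₁-step : ∀ k → suc k < h → σ (run₁ k) ≡ run₁ (suc k)
  run₁-step k lt with even-or-odd k
  ... | inj₁ (K , refl) = trans (cong σ (if-T (even-double K))) (trans (σ-plus-odd lt) (sym (if-¬T (odd-double K))))
  ... | inj₂ (K , refl) = trans (cong σ (if-¬T (odd-double K))) (trans (σ-minus-even lt) (sym (if-T (even-double K))))

  run₃-step : ∀ k → suc k < h → σ (run₃ k) ≡ run₃ (suc k)
  run₃-step k lt with even-or-odd k
  ... | inj₁ (K , refl) = trans (cong σ (if-T (even-double K))) (trans (σ-minus-even lt) (sym (if-¬T (odd-double K))))
  ... | inj₂ (K , refl) = trans (cong σ (if-¬T (odd-double K))) (trans (σ-plus-odd lt) (sym (if-T (even-double K))))

  run₂-step : ∀ j → suc j < h → σ (run₂ j) ≡ run₂ (suc j)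
  run₂-step j lt with halves lt
  ... | d , q≡′ = trans (cong (σ ∘ minus) here≡) (trans (if-¬T (odd-double d)) (cong minus (sym next≡)))
    where
    here≡ : q ∸ suc (j + j) ≡ 3 + (d + d)
    here≡ = trans (cong (_∸ suc (j + j)) (trans q≡′ (solve 2 (λ j d → (con 2 :+ j :+ d) :+ (con 2 :+ j :+ d) := (con 1 :+ (j :+ j)) :+ (con 3 :+ (d :+ d))) refl j d)))
                  (m+n∸m≡n (suc (j + j)) (3 + (d + d)))
    next≡ : q ∸ suc (suc j + suc j) ≡ suc (d + d)
    next≡ = trans (cong (_∸ suc (suc j + suc j)) (trans q≡′ (solve 2 (λ j d → (con 2 :+ j :+ d) :+ (con 2 :+ j :+ d)
                                                                        := (con 1 :+ ((con 1 :+ j) :+ (con 1 :+ j))) :+ (con 1 :+ (d :+ d))) refl j d)))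
                  (m+n∸m≡n (suc (suc j + suc j)) (suc (d + d)))

  run₄-step : ∀ j → suc j < h → σ (run₄ j) ≡ run₄ (suc j)
  run₄-step j lt with halves lt
  ... | d , q≡′ = trans (cong (σ ∘ plus) here≡) (trans (if-T (even-double d)) (cong plus (sym next≡)))
    where
    here≡ : q ∸ (j + j) ≡ 4 + (d + d)
    here≡ = trans (cong (_∸ (j + j)) (trans q≡′ (solve 2 (λ j d → (con 2 :+ j :+ d) :+ (con 2 :+ j :+ d) := (j :+ j) :+ (con 4 :+ (d :+ d))) refl j d)))
                  (m+n∸m≡n (j + j) (4 + (d + d)))
    next≡ : q ∸ (suc j + suc j) ≡ 2 + (d + d)
    next≡ = trans (cong (_∸ (suc j + suc j)) (trans q≡′ (solve 2 (λ j d → (con 2 :+ j :+ d) :+ (con 2 :+ j :+ d)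
                                                                      := ((con 1 :+ j) :+ (con 1 :+ j)) :+ (con 2 :+ (d :+ d))) refl j d)))
                  (m+n∸m≡n (suc j + suc j) (2 + (d + d)))

  run₁-last : σ (run₁ last) ≡ minus (suc q)
  run₁-last = trans (cong σ (trans (if-¬T odd-last) (cong minus (sym q≡)))) σ-minus-q

  run₂-last : σ (run₂ last) ≡ run₃ 0
  run₂-last = cong (σ ∘ minus) (trans (cong (_∸ suc (last + last)) (trans q≡ (cong suc (+-comm 1 (last + last))))) (m+n∸m≡n (suc (last + last)) 1))

  run₃-last : σ (run₃ last) ≡ u₂
  run₃-last = trans (cong σ (trans (if-¬T odd-last) (cong plus (sym pred-q≡)))) σ-plus-pred-q

  run₄-last : σ (run₄ last) ≡ u₀
  run₄-last = cong (σ ∘ plus) (trans (cong (_∸ (last + last)) (trans q≡ (+-comm 2 (last + last)))) (m+n∸m≡n (last + last) 2))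

  private
    last<h : last < h
    last<h = ≤-refl

  u₀↝run₁ : ∀ {k} → k < h → u₀ ↝ run₁ k
  u₀↝run₁ k<h = ↝-trans (↝-step refl) (along-run run₁ run₁-step z≤n k<h)

  u₀↝minus-suc-q : u₀ ↝ minus (suc q)
  u₀↝minus-suc-q = ↝-trans (u₀↝run₁ last<h) (↝-step run₁-last)

  u₀↝run₂ : ∀ {j} → j < h → u₀ ↝ run₂ j
  u₀↝run₂ j<h = ↝-trans u₀↝minus-suc-q (↝-trans (↝-step σ-minus-suc-q) (along-run run₂ run₂-step z≤n j<h))

  u₀↝run₃ : ∀ {k} → k < h → u₀ ↝ run₃ k
  u₀↝run₃ k<h = ↝-trans (u₀↝run₂ last<h) (↝-trans (↝-step run₂-last) (along-run run₃ run₃-step z≤n k<h))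

  u₀↝u₂ : u₀ ↝ u₂
  u₀↝u₂ = ↝-trans (u₀↝run₃ last<h) (↝-step run₃-last)

  u₀↝plus-suc-q : u₀ ↝ plus (suc q)
  u₀↝plus-suc-q = ↝-trans u₀↝u₂ (↝-step refl)

  u₀↝u₁ : u₀ ↝ u₁
  u₀↝u₁ = ↝-trans u₀↝plus-suc-q (↝-step σ-plus-suc-q)

  u₀↝run₄ : ∀ {j} → j < h → u₀ ↝ run₄ j
  u₀↝run₄ j<h = ↝-trans u₀↝u₁ (↝-trans (↝-step refl) (along-run run₄ run₄-step z≤n j<h))

  run₄↝u₀ : ∀ {j} → j < h → run₄ j ↝ u₀
  run₄↝u₀ j<h = ↝-trans (along-run run₄ run₄-step (≤-pred j<h) last<h) (↝-step run₄-last)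

  u₁↝u₀ : u₁ ↝ u₀
  u₁↝u₀ = ↝-trans (↝-step refl) (run₄↝u₀ (s≤s z≤n))

  plus-suc-q↝u₀ : plus (suc q) ↝ u₀
  plus-suc-q↝u₀ = ↝-trans (↝-step σ-plus-suc-q) u₁↝u₀

  u₂↝u₀ : u₂ ↝ u₀
  u₂↝u₀ = ↝-trans (↝-step refl) plus-suc-q↝u₀

  run₃↝u₀ : ∀ {k} → k < h → run₃ k ↝ u₀
  run₃↝u₀ k<h = ↝-trans (along-run run₃ run₃-step (≤-pred k<h) last<h) (↝-trans (↝-step run₃-last) u₂↝u₀)

  run₂↝u₀ : ∀ {j} → j < h → run₂ j ↝ u₀
  run₂↝u₀ j<h = ↝-trans (along-run run₂ run₂-step (≤-pred j<h) last<h) (↝-trans (↝-step run₂-last) (run₃↝u₀ (s≤s z≤n)))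

  minus-suc-q↝u₀ : minus (suc q) ↝ u₀
  minus-suc-q↝u₀ = ↝-trans (↝-step σ-minus-suc-q) (run₂↝u₀ (s≤s z≤n))

  run₁↝u₀ : ∀ {k} → k < h → run₁ k ↝ u₀
  run₁↝u₀ k<h = ↝-trans (along-run run₁ run₁-step (≤-pred k<h) last<h) (↝-trans (↝-step run₁-last) minus-suc-q↝u₀)

  OnCycle : Symbol → Set
  OnCycle c = u₀ ↝ c × c ↝ u₀

  on-cycle : ∀ {c} → Valid c → OnCycle c
  on-cycle {u₀} _ = ↝-refl , ↝-refl
  on-cycle {u₁} _ = u₀↝u₁ , u₁↝u₀
  on-cycle {u₂} _ = u₀↝u₂ , u₂↝u₀
  on-cycle {plus a} (1≤a , a≤) with a ≟ suc q
  ... | yes refl = u₀↝plus-suc-q , plus-suc-q↝u₀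
  ... | no a≢ with even-or-odd a
  ...   | inj₁ (k , refl) = subst OnCycle (cong plus run₄≡) (u₀↝run₄ r<h , run₄↝u₀ r<h)
    where
    k≤h : k ≤ h
    k≤h = half-≤ (≤-pred (≤∧≢⇒< a≤ a≢))
    1≤k : 1 ≤ k
    1≤k = n≢0⇒n>0 (λ k≡0 → <-irrefl (sym (cong (λ x → x + x) k≡0)) 1≤a)
    r : ℕ
    r = h ∸ k
    r<h : r < h
    r<h = ∸-monoʳ-< {h} {k} {0} 1≤k k≤h
    run₄≡ : q ∸ (r + r) ≡ k + k
    run₄≡ = trans (cong (_∸ (r + r)) (trans (cong₂ _+_ (sym (m+[n∸m]≡n k≤h)) (sym (m+[n∸m]≡n k≤h)))
                    (solve 2 (λ k r → (k :+ r) :+ (k :+ r) := (r :+ r) :+ (k :+ k)) refl k r)))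
                  (m+n∸m≡n (r + r) (k + k))
  ...   | inj₂ (k , refl) with T? (even k)
  ...     | yes even-k = subst OnCycle (if-T even-k) (u₀↝run₁ k<h , run₁↝u₀ k<h)
    where
    k<h : k < h
    k<h = half-< (≤-pred (≤∧≢⇒< a≤ a≢))
  ...     | no  odd-k  = subst OnCycle (if-¬T odd-k) (u₀↝run₃ k<h , run₃↝u₀ k<h)
    where
    k<h : k < h
    k<h = half-< (≤-pred (≤∧≢⇒< a≤ a≢))
  on-cycle {minus t} (1≤t , t≤) with t ≟ suc q
  ... | yes refl = u₀↝minus-suc-q , minus-suc-q↝u₀
  ... | no t≢ with even-or-odd t
  ...   | inj₂ (k , refl) = subst OnCycle (cong minus run₂≡) (u₀↝run₂ r<h , run₂↝u₀ r<h)
    where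
    k<h : k < h
    k<h = half-< (≤-pred (≤∧≢⇒< t≤ t≢))
    r : ℕ
    r = h ∸ suc k
    r<h : r < h
    r<h = ∸-monoʳ-< {h} {suc k} {0} (s≤s z≤n) k<h
    run₂≡ : q ∸ suc (r + r) ≡ suc (k + k)
    run₂≡ = trans (cong (_∸ suc (r + r)) (trans (cong₂ _+_ (sym (m+[n∸m]≡n k<h)) (sym (m+[n∸m]≡n k<h)))
                    (solve 2 (λ k r → (con 1 :+ k :+ r) :+ (con 1 :+ k :+ r) := (con 1 :+ (r :+ r)) :+ (con 1 :+ (k :+ k))) refl k r)))
                  (m+n∸m≡n (suc (r + r)) (suc (k + k)))
  ...   | inj₁ (zero , refl) = ⊥-elim (<-irrefl refl 1≤t)
  ...   | inj₁ (suc k , refl) with T? (even k)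
  ...     | yes even-k = subst OnCycle (trans (if-T even-k) (cong minus (sym t≡))) (u₀↝run₃ k<h , run₃↝u₀ k<h)
    where
    t≡ : suc k + suc k ≡ 2 + (k + k)
    t≡ = cong suc (+-suc k k)
    k<h : k < h
    k<h = half-≤ (≤suc-q⇒≤q (suc k) t≤)
  ...     | no  odd-k  = subst OnCycle (trans (if-¬T odd-k) (cong minus (sym t≡))) (u₀↝run₁ k<h , run₁↝u₀ k<h)
    where
    t≡ : suc k + suc k ≡ 2 + (k + k)
    t≡ = cong suc (+-suc k k)
    k<h : k < h
    k<h = half-≤ (≤suc-q⇒≤q (suc k) t≤)

  σ-cyclic : ∀ {c c′} → Valid c → Valid c′ → c ↝ c′
  σ-cyclic vc vc′ = ↝-trans (proj₂ (on-cycle vc)) (proj₁ (on-cycle vc′))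

  rotℕ-< : ∀ x y → rotℕ x y < 3 + m
  rotℕ-< x y with vertex-view x
  ... | triangle-vertex {c} c<3 = subst (_< 3 + m) (sym (rotℕ-triangle y c<3)) (+-monoʳ-< 3 (⊕-< (y ∸ 3) (step c)))
  ... | residue-vertex z       = subst (_< 3 + m) (sym (rotℕ-residue z y)) (neighbour-< z (σ (symbolOf z y)))

  rotℕ-adj : ∀ {x y} → x < 3 + m → y < 3 + m → Adjℕ 3 x y → Adjℕ 3 x (rotℕ x y)
  rotℕ-adj {x} {y} x< y< (x≢y , _) with vertex-view x
  ... | triangle-vertex {c} c<3 = subst (Adjℕ 3 c) (sym (rotℕ-triangle y c<3))
          ((λ e → <⇒≢ (<-≤-trans c<3 (m≤m+n 3 _)) e) , λ (_ , r<3) → m+n≮m 3 _ r<3)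
  ... | residue-vertex z with symbolOf-spec {z} {y} (≤-pred (≤-pred (≤-pred x<))) y< (x≢y ∘ sym)
  ...   | valid , _ = subst (Adjℕ 3 (3 + z)) (sym (rotℕ-residue z y))
          ((λ e → neighbour-≢ {z} {σ (symbolOf z y)} (≤-pred (≤-pred (≤-pred x<))) (σ-valid {symbolOf z y} valid) (sym e)) , λ (3+z<3 , _) → m+n≮m 3 z 3+z<3)

  rotℕ-neighbour : ∀ {z c} → z < m → Valid c → rotℕ (3 + z) (neighbour z c) ≡ neighbour z (σ c)
  rotℕ-neighbour {z} {c} z<m vc = trans (rotℕ-residue z _) (cong (neighbour z ∘ σ) (symbolOf-neighbour {z} {c} z<m vc))

  iter-rotℕ-neighbour : ∀ {z c} → z < m → Valid c → ∀ k → iter (rotℕ (3 + z)) k (neighbour z c) ≡ neighbour z (iter σ k c)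
  iter-rotℕ-neighbour z<m vc zero = refl
  iter-rotℕ-neighbour {z} {c} z<m vc (suc k) =
    trans (cong (rotℕ (3 + z)) (iter-rotℕ-neighbour z<m vc k)) (rotℕ-neighbour {c = iter σ k c} z<m (iter-σ-valid k {c} vc))

  iter-rotℕ-triangle : ∀ {c w} → c < 3 → w < m → ∀ k → iter (rotℕ c) k (3 + w) ≡ 3 + w ⊕ (k * step c)
  iter-rotℕ-triangle c<3 w<m zero = cong (3 +_) (sym (⊕-identity w<m ≈-refl))
  iter-rotℕ-triangle {c} {w} c<3 w<m (suc k) = begin
    rotℕ c (iter (rotℕ c) k (3 + w))  ≡⟨ cong (rotℕ c) (iter-rotℕ-triangle c<3 w<m k) ⟩
    rotℕ c (3 + w ⊕ (k * s))          ≡⟨ rotℕ-triangle _ c<3 ⟩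
    3 + w ⊕ (k * s) ⊕ s               ≡⟨ cong (3 +_) (⊕-assoc w (k * s) s) ⟩
    3 + w ⊕ (k * s + s)               ≡⟨ cong (λ x → 3 + w ⊕ x) (+-comm (k * s) s) ⟩
    3 + w ⊕ (suc k * s)               ∎
    where
    open ≡-Reasoning
    s : ℕ
    s = step c

  -- The step m ∸ 2 = 2q + 1 of u₂ is inverted by q + 1 modulo m = 2q + 3.
  step-invertible : ∀ {c} → c < 3 → ∀ D → ∃[ k ] ∃[ t ] k * step c ≡ D + t * m
  step-invertible {0} _ D = D , 0 , trans (*-identityʳ D) (sym (+-identityʳ D))
  step-invertible {1} _ D = D , 0 , trans (*-identityʳ D) (sym (+-identityʳ D))
  step-invertible {2} _ D = D * suc q , D * q ,
    solve 2 (λ D q → (D :* (con 1 :+ q)) :* (con 1 :+ (q :+ q)) := D :+ (D :* q) :* (con 3 :+ (q :+ q))) refl D q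
  step-invertible {suc (suc (suc _))} (s≤s (s≤s (s≤s ())))

  triangle-reach : ∀ {c w w′} → c < 3 → w < m → w′ < m → ∃[ k ] iter (rotℕ c) k (3 + w) ≡ 3 + w′
  triangle-reach {c} {w} {w′} c<3 w<m w′<m with step-invertible c<3 ((m ∸ w) + w′)
  ... | k , t , k*step≡ = k , (begin
    iter (rotℕ c) k (3 + w)       ≡⟨ iter-rotℕ-triangle c<3 w<m k ⟩
    3 + w ⊕ (k * step c)          ≡⟨ cong (λ x → 3 + w ⊕ x) k*step≡ ⟩
    3 + w ⊕ (D + t * m)           ≡⟨ cong (3 +_) (⊕-multiple w D t) ⟩
    3 + w ⊕ D                     ≡⟨ cong (3 +_) (⊕-reach w<m w′<m) ⟩
    3 + w′                        ∎)
    where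
    open ≡-Reasoning
    D : ℕ
    D = (m ∸ w) + w′

  order≡ : 8 * suc n + 6 ≡ 3 + m
  order≡ = solve 1 (λ n → let h = (con 1 :+ n) :+ (con 1 :+ n) ; q = h :+ h in
                      con 8 :* (con 1 :+ n) :+ con 6 := con 3 :+ (con 3 :+ (q :+ q))) refl n

  euler-count : 4 * (3 + m) + 8 * (8 * suc n * suc n + 7 * suc n + 1) ≡ 3 * m + m * (2 + m) + 8
  euler-count = solve 1 (λ n → let h = (con 1 :+ n) :+ (con 1 :+ n) ; q = h :+ h ; m = con 3 :+ (q :+ q) in
                  con 4 :* (con 3 :+ m) :+ con 8 :* (con 8 :* (con 1 :+ n) :* (con 1 :+ n) :+ con 7 :* (con 1 :+ n) :+ con 1)
                  := con 3 :* m :+ m :* (con 2 :+ m) :+ con 8) refl n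

  rotℕ-cyclic : ∀ {x u w} → x < 3 + m → u < 3 + m → w < 3 + m → Adjℕ 3 x u → Adjℕ 3 x w → ∃[ k ] iter (rotℕ x) k u ≡ w
  rotℕ-cyclic {x} {u} {w} x< u< w< (x≢u , ¬both-u) (x≢w , ¬both-w) with vertex-view x
  ... | triangle-vertex c<3 with vertex-view u | vertex-view w
  ...   | triangle-vertex u<3 | _                   = ⊥-elim (¬both-u (c<3 , u<3))
  ...   | residue-vertex _    | triangle-vertex w<3 = ⊥-elim (¬both-w (c<3 , w<3))
  ...   | residue-vertex a    | residue-vertex b    = triangle-reach c<3 (≤-pred (≤-pred (≤-pred u<))) (≤-pred (≤-pred (≤-pred w<)))
  rotℕ-cyclic {x} {u} {w} x< u< w< (x≢u , _) (x≢w , _) | residue-vertex z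
    with symbolOf-spec {z} {u} z<m u< (x≢u ∘ sym) | symbolOf-spec {z} {w} z<m w< (x≢w ∘ sym)
    where
    z<m : z < m
    z<m = ≤-pred (≤-pred (≤-pred x<))
  ... | valid-u , neighbour-u | valid-w , neighbour-w with σ-cyclic {symbolOf z u} {symbolOf z w} valid-u valid-w
  ...   | k , σᵏ≡ = k , (begin
    iter (rotℕ (3 + z)) k u                              ≡⟨ cong (iter (rotℕ (3 + z)) k) neighbour-u ⟨
    iter (rotℕ (3 + z)) k (neighbour z (symbolOf z u))   ≡⟨ iter-rotℕ-neighbour (≤-pred (≤-pred (≤-pred x<))) valid-u k ⟩
    neighbour z (iter σ k (symbolOf z u))                ≡⟨ cong (neighbour z) σᵏ≡ ⟩
    neighbour z (symbolOf z w)                           ≡⟨ neighbour-w ⟩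
    w                                                    ∎)
    where open ≡-Reasoning

lemma9 : (s : ℕ) → 1 ≤ s → QuadEmbedding (8 * s + 6) 3 (8 * s * s + 7 * s + 1)
lemma9 (suc n) _ = subst (λ p → QuadEmbedding p 3 genus) (sym order≡)
  (R , Q , quadrangular⇒genus R Q (s≤s (s≤s (s≤s (s≤s z≤n)))) genus euler)
  where
  open Construction n
  genus : ℕ
  genus = 8 * suc n * suc n + 7 * suc n + 1
  R : RotationSystem (3 + m) 3
  R = rotationSystemℕ rotℕ rotℕ-< rotℕ-adj rotℕ-cyclic
  Q : Quadrangular R
  Q = quadrangularℕ rotℕ rotℕ-< rotℕ-adj rotℕ-cyclic (s≤s (s≤s (s≤s (s≤s (s≤s (s≤s z≤n)))))) closes
  euler : 4 * (3 + m) + 8 * genus ≡ length (darts R) + 8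
  euler = trans euler-count (cong (_+ 8) (sym (length-darts R refl)))
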